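{- Let $b \ge 3$ be an integer and let $\gamma_{0,b,2} = b+2, b+1, \ldots, 3, b+3, 2, 1 \in S_{b+3}$. Then for all $n \ge 3$, $$|S_n(132, 123, \gamma_{0,b,2})| = \frac{1}{b-1} \left( 3 F_{b,n+1} + (b-4) F_{b,n-1} + 3 \sum_{i=3}^{b-1} (b-i) F_{b,n-i+1} - 3 \right),$$ and also, for all $n\ge 3$, $$|S_n(132, 123, \gamma_{0,b,2})| = \sum_{k=1}^{n-1} F_{b,k} + 2 \sum_{k=1}^{n-2} F_{b,k}.$$ Moreover, $$\sum_{n=0}^\infty |S_n(132, 123, \gamma_{0,b,2})| x^n = 1 + x + x^2 + \frac{x^2 + 2x^3}{1-2x+x^{b+1}}.$$
   Context: $S_n$ is the set of permutations of $\{1,\dots,n\}$ in one-line notation; $\pi$ avoids $\sigma\in S_k$ if no subsequence of $\pi$ of length $k$ has the same relative order as $\sigma$; $S_n(R)$ is the set of $\pi\in S_n$ avoiding every element of $R$, and $S_0(R)$ contains only the empty permutation. For $k\ge1$, $F_{k,n}=0$ for $n\le 0$, $F_{k,1}=1$, and $F_{k,n}=\sum_{i=1}^k F_{k,n-i}$ for $n \ge 2$. -}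

module Defs where

open import Data.Nat using (ℕ; zero; suc; _+_; _∸_; _<ᵇ_; _≡ᵇ_)
open import Data.Bool using (Bool; true; false; not; _∧_; _xor_; if_then_else_)
open import Data.List using (List; []; _∷_; _++_; map; concatMap; filterᵇ; length;
  foldr; take; reverse; upTo)
open import Data.Bool.ListAction using (all; any)
open import Data.Nat.ListAction using (sum)
open import Data.Product using (_×_; _,_)
import Data.Integer as ℤ
open ℤ using (ℤ; +_)

-- Permutations in one-line notation, as lists of naturals.

oneTo : ℕ → List ℕ
oneTo n = map suc (upTo n)

words : List ℕ → ℕ → List (List ℕ)
words xs zero    = [] ∷ []
words xs (suc k) = concatMap (λ x → map (x ∷_) (words xs k)) xs

distinct : List ℕ → Bool
distinct []       = true
distinct (x ∷ xs) = all (λ y → not (x ≡ᵇ y)) xs ∧ distinct xs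

perms : ℕ → List (List ℕ)
perms n = filterᵇ distinct (words (oneTo n) n)

subseqs : ℕ → List ℕ → List (List ℕ)
subseqs zero    _        = [] ∷ []
subseqs (suc k) []       = []
subseqs (suc k) (x ∷ xs) = map (x ∷_) (subseqs k xs) ++ subseqs (suc k) xs

_⇔ᵇ_ : Bool → Bool → Bool
a ⇔ᵇ b = not (a xor b)

zipL : List ℕ → List ℕ → List (ℕ × ℕ)
zipL (x ∷ xs) (y ∷ ys) = (x , y) ∷ zipL xs ys
zipL _ _ = []

sameOrderPairs : List (ℕ × ℕ) → Bool
sameOrderPairs [] = true
sameOrderPairs ((a , b) ∷ rest) =
  all (λ { (a' , b') → ((a <ᵇ a') ⇔ᵇ (b <ᵇ b')) ∧ ((a' <ᵇ a) ⇔ᵇ (b' <ᵇ b)) }) rest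
  ∧ sameOrderPairs rest

sameOrder : List ℕ → List ℕ → Bool
sameOrder τ σ = (length τ ≡ᵇ length σ) ∧ sameOrderPairs (zipL τ σ)

contains : List ℕ → List ℕ → Bool
contains σ π = any (λ τ → sameOrder τ σ) (subseqs (length σ) π)

avoidsAll : List (List ℕ) → List ℕ → Bool
avoidsAll R π = all (λ σ → not (contains σ π)) R

countAvoiders : List (List ℕ) → ℕ → ℕ
countAvoiders R n = length (filterᵇ (avoidsAll R) (perms n))

gamma : ℕ → List ℕ
gamma b = reverse (map (_+ 3) (upTo b)) ++ (b + 3) ∷ 2 ∷ 1 ∷ []

patterns : ℕ → List (List ℕ)
patterns b = (1 ∷ 3 ∷ 2 ∷ []) ∷ (1 ∷ 2 ∷ 3 ∷ []) ∷ gamma b ∷ []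

-- k-generalized Fibonacci numbers F_{k,n}, n ∈ ℕ.
-- F_{k,n} = 0 for n ≤ 0 (only n = 0 arises here, via truncated subtraction),
-- F_{k,1} = 1, F_{k,n} = Σ_{i=1}^k F_{k,n-i} for n ≥ 2.

-- fibHist k n = [F_{k,n}, F_{k,n-1}, ..., F_{k,1}]
fibHist : ℕ → ℕ → List ℕ
fibHist k zero          = []
fibHist k (suc zero)    = 1 ∷ []
fibHist k (suc (suc m)) = sum (take k (fibHist k (suc m))) ∷ fibHist k (suc m)

headOr0 : List ℕ → ℕ
headOr0 []      = 0
headOr0 (x ∷ _) = x

F : ℕ → ℕ → ℕ
F k n = headOr0 (fibHist k n)

-- [a, a+1, ..., c]  (empty if c < a)
fromTo : ℕ → ℕ → List ℕ
fromTo a c = map (λ j → a + j) (upTo (suc c ∸ a))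

sumℕ : ℕ → ℕ → (ℕ → ℕ) → ℕ
sumℕ a c f = sum (map f (fromTo a c))

sumℤ : ℕ → ℕ → (ℕ → ℤ) → ℤ
sumℤ a c f = foldr ℤ._+_ (+ 0) (map f (fromTo a c))

Series : Set
Series = ℕ → ℤ

infixl 6 _⊕_
infixl 7 _⊗_

_⊕_ : Series → Series → Series
(f ⊕ g) n = f n ℤ.+ g n

_⊗_ : Series → Series → Series
(f ⊗ g) n = sumℤ 0 n (λ i → f i ℤ.* g (n ∸ i))

mono : ℤ → ℕ → Series
mono c k n = if n ≡ᵇ k then c else + 0

ogf : List (List ℕ) → Series
ogf R n = + countAvoiders R n

module Submission where

-- A permutation avoids 123 and 132 exactly when each entry is the largest or the second largest of
-- the entries from it onwards.  So an avoider of {1,…,m+1} starts with a run m, m−1, …, j+1 of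
-- second-largest entries, then its maximum, then an avoider of {1,…,j}.  An occurrence of γ either
-- lies in that final avoider or consists of b entries of the run, the maximum and a descent after
-- it; and the only descent-free avoiders are (), 1 and 12.  Enumerating along this decomposition
-- shows that the number a(n) of avoiders satisfies a(n+1) = a(n) + ⋯ + a(n−b+1) + (a term for the
-- runs of length ≥ b).  Σ_{k<n} F_{b,k} + 2 Σ_{k<n−1} F_{b,k} + [n ≤ 2] satisfies the same
-- recurrence, which gives the second formula; the first is a linear identity between generalized
-- Fibonacci numbers proved by induction, and the generating function comes from the second-order
-- form a(n+2) − 2 a(n+1) + a(n+1−b) = [n+1−b ∈ {0,1,2}] of the recurrence.

open import Defs
open import Data.Nat as ℕ
  using (ℕ; zero; suc; _+_; _*_; _∸_; _≤_; _<_; _>_; z≤n; s≤s; _<ᵇ_; _≡ᵇ_; _≤?_)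
open import Data.Nat.Properties
open import Data.Nat.ListAction using (sum)
open import Data.Nat.ListAction.Properties using (sum-++)
open import Data.Bool using (Bool; true; false; not; _∧_; T; T?)
open import Data.Bool.Properties using (T-∧)
open import Data.Bool.ListAction using (all)
import Data.List as List
open import Data.List
  using (List; []; _∷_; _++_; map; concatMap; filterᵇ; length; foldr; take; reverse; upTo
        ; applyDownFrom; applyUpTo)
open import Data.List.Properties
  using (length-++; length-map; map-upTo; reverse-applyUpTo; length-applyDownFrom; map-++
        ; map-cong; map-∘; upTo-∷ʳ; foldr-++; ++-assoc; length-upTo; ++-identityʳ; ∷-injectiveˡ
        ; ∷-injectiveʳ)
open import Data.List.Membership.Propositional using (_∈_; find; lose)
open import Data.List.Membership.Propositional.Properties
  using (∈-++⁺ˡ; ∈-++⁺ʳ; ∈-++⁻; ∈-map⁺; ∈-map⁻; ∈-∃++; ∈-upTo⁺; ∈-upTo⁻; ∈-applyDownFrom⁻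
        ; ∈-concatMap⁺; ∈-concatMap⁻; ∈-filter⁺; ∈-filter⁻)
open import Data.List.Relation.Unary.Any using (here; there)
open import Data.List.Relation.Unary.Any.Properties using (any⁺; any⁻)
open import Data.List.Relation.Unary.All as All using (All; []; _∷_)
open import Data.List.Relation.Unary.All.Properties using (all⁺; all⁻; ++⁻ʳ)
import Data.List.Relation.Unary.All.Properties as All
open import Data.List.Relation.Unary.AllPairs using (AllPairs; []; _∷_)
import Data.List.Relation.Unary.AllPairs.Properties as AllPairs
open import Data.List.Relation.Unary.Unique.Propositional using (Unique)
import Data.List.Relation.Unary.Unique.Propositional.Properties as Unique
open import Data.List.Relation.Binary.Sublist.Propositional
  using (_⊆_; []; _∷_; _∷ʳ_; ⊆-refl; ⊆-trans)
open import Data.List.Relation.Binary.Sublist.Propositional.Properties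
  using ([]⊆-universal; length-mono-≤; Any-resp-⊆; ++⁺ˡ; ++⁺; filter-⊆; ∷⁻)
open import Data.Product using (∃; ∃₂; _,_; proj₁; proj₂; _×_)
import Data.Product as Product
open import Data.Sum using (_⊎_; inj₁; inj₂)
open import Data.Empty using (⊥; ⊥-elim)
open import Function using (_∘_; Equivalence)
open import Relation.Binary.PropositionalEquality
  using (_≡_; refl; sym; trans; cong; cong₂; subst; _≢_; module ≡-Reasoning)
open import Relation.Nullary using (¬_; yes; no)
open import Relation.Binary.Definitions using (tri<; tri≈; tri>)
open import Data.Nat.Tactic.RingSolver using (solve-∀)
open import Data.Integer as ℤ using (ℤ; +_)
import Data.Integer.Properties as ℤP
open import Data.Integer.Tactic.RingSolver using () renaming (solve-∀ to ℤ-solve-∀)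

∧-split : ∀ {a b} → T (a ∧ b) → T a × T b
∧-split = Equivalence.to T-∧

∧-intro : ∀ {a b} → T a → T b → T (a ∧ b)
∧-intro p q = Equivalence.from T-∧ (p , q)

T-not⇒¬T : ∀ {a} → T (not a) → ¬ T a
T-not⇒¬T {false} _ ()

¬T⇒T-not : ∀ {a} → ¬ T a → T (not a)
¬T⇒T-not {false} _  = _
¬T⇒T-not {true}  ¬t = ¬t _

<ᵇ-true : ∀ {m n} → m < n → (m <ᵇ n) ≡ true
<ᵇ-true {zero}  {suc n} _       = refl
<ᵇ-true {suc m} {suc n} (s≤s p) = <ᵇ-true p

<ᵇ-false : ∀ {m n} → n ≤ m → (m <ᵇ n) ≡ false
<ᵇ-false {m}     {zero}  _       = refl
<ᵇ-false {suc m} {suc n} (s≤s p) = <ᵇ-false p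

≡ᵇ-refl : ∀ n → (n ≡ᵇ n) ≡ true
≡ᵇ-refl zero    = refl
≡ᵇ-refl (suc n) = ≡ᵇ-refl n

≡ᵇ-false : ∀ {m n} → m ≢ n → (m ≡ᵇ n) ≡ false
≡ᵇ-false {zero}  {zero}  m≢n = ⊥-elim (m≢n refl)
≡ᵇ-false {zero}  {suc n} _   = refl
≡ᵇ-false {suc m} {zero}  _   = refl
≡ᵇ-false {suc m} {suc n} m≢n = ≡ᵇ-false (m≢n ∘ cong suc)

≢⇒T-not-≡ᵇ : ∀ {m n} → m ≢ n → T (not (m ≡ᵇ n))
≢⇒T-not-≡ᵇ m≢n rewrite ≡ᵇ-false m≢n = _

T-not-≡ᵇ⇒≢ : ∀ {m n} → T (not (m ≡ᵇ n)) → m ≢ n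
T-not-≡ᵇ⇒≢ {m} t refl rewrite ≡ᵇ-refl m = t

length-≤-unique : ∀ {A : Set} {xs ys : List A} → Unique xs → (∀ {z} → z ∈ xs → z ∈ ys) →
                  length xs ≤ length ys
length-≤-unique {xs = []}     _            _   = z≤n
length-≤-unique {xs = x ∷ xs} (x∉xs ∷ xs!) sub
  with ys₁ , ys₂ , refl ← ∈-∃++ (sub (here refl)) = begin
  suc (length xs)               ≤⟨ s≤s (length-≤-unique xs! sub′) ⟩
  suc (length (ys₁ ++ ys₂))     ≡⟨ cong suc (length-++ ys₁) ⟩
  suc (length ys₁ + length ys₂) ≡⟨ +-suc (length ys₁) (length ys₂) ⟨
  length ys₁ + length (x ∷ ys₂) ≡⟨ length-++ ys₁ ⟨
  length (ys₁ ++ x ∷ ys₂)       ∎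
  where
  open ≤-Reasoning
  sub′ : ∀ {z} → z ∈ xs → z ∈ ys₁ ++ ys₂
  sub′ z∈xs with ∈-++⁻ ys₁ (sub (there z∈xs))
  ... | inj₁ z∈ys₁         = ∈-++⁺ˡ z∈ys₁
  ... | inj₂ (here refl)   = ⊥-elim (All.lookup x∉xs z∈xs refl)
  ... | inj₂ (there z∈ys₂) = ∈-++⁺ʳ ys₁ z∈ys₂

length-≡-unique : ∀ {A : Set} {xs ys : List A} → Unique xs → Unique ys →
                  (∀ {z} → z ∈ xs → z ∈ ys) → (∀ {z} → z ∈ ys → z ∈ xs) → length xs ≡ length ys
length-≡-unique xs! ys! xs⊆ys ys⊆xs =
  ≤-antisym (length-≤-unique xs! xs⊆ys) (length-≤-unique ys! ys⊆xs)

length-filterᵇ-split : ∀ {A : Set} (p : A → Bool) xs →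
                       length xs ≡ length (filterᵇ p xs) + length (filterᵇ (not ∘ p) xs)
length-filterᵇ-split p []       = refl
length-filterᵇ-split p (x ∷ xs) with p x
... | true  = cong suc (length-filterᵇ-split p xs)
... | false = trans (cong suc (length-filterᵇ-split p xs)) (sym (+-suc _ _))

Unique-pair : ∀ {A : Set} {y w : A} {π} → Unique π → (y ∷ w ∷ []) ⊆ π → y ≢ w
Unique-pair (_ ∷ π!)  (_ ∷ʳ p)    = Unique-pair π! p
Unique-pair (y∉π ∷ _) (refl ∷ p)  = All.lookup y∉π (Any-resp-⊆ p (here refl))

distinct⇒Unique : ∀ xs → T (distinct xs) → Unique xs
distinct⇒Unique []       _ = []
distinct⇒Unique (x ∷ xs) d =
  let new , rest = ∧-split d in All.map T-not-≡ᵇ⇒≢ (all⁺ _ xs new) ∷ distinct⇒Unique xs rest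

Unique⇒distinct : ∀ {xs} → Unique xs → T (distinct xs)
Unique⇒distinct []           = _
Unique⇒distinct (x∉xs ∷ xs!) = ∧-intro (all⁻ _ (All.map ≢⇒T-not-≡ᵇ x∉xs)) (Unique⇒distinct xs!)

∈-words⁻ : ∀ xs k {π} → π ∈ words xs k → length π ≡ k × All (_∈ xs) π
∈-words⁻ xs zero    (here refl) = refl , []
∈-words⁻ xs (suc k) p with find (∈-concatMap⁻ (λ x → map (x ∷_) (words xs k)) {xs = xs} p)
... | x , x∈xs , q with ∈-map⁻ (x ∷_) q
...   | π , r , refl = Product.map (cong suc) (x∈xs ∷_) (∈-words⁻ xs k r)

∈-words⁺ : ∀ xs {π} → All (_∈ xs) π → π ∈ words xs (length π)
∈-words⁺ xs []           = here refl
∈-words⁺ xs {x ∷ π} (x∈xs ∷ π∈) =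
  ∈-concatMap⁺ (λ y → map (y ∷_) (words xs (length π)))
               (lose x∈xs (∈-map⁺ (x ∷_) (∈-words⁺ xs π∈)))

Unique-words : ∀ {xs} k → Unique xs → Unique (words xs k)
Unique-words zero    _   = [] ∷ []
Unique-words {xs} (suc k) xs! = go xs!
  where
  step : ℕ → List (List ℕ)
  step y = map (y ∷_) (words xs k)
  go : ∀ {ys} → Unique ys → Unique (concatMap step ys)
  go []                       = []
  go {y ∷ ys} (y∉ys ∷ ys!) = Unique.++⁺ (Unique.map⁺ ∷-injectiveʳ (Unique-words k xs!)) (go ys!) disjoint
    where
    disjoint : ∀ {π} → ¬ (π ∈ step y × π ∈ concatMap step ys)
    disjoint (p , q) with find (∈-concatMap⁻ step {xs = ys} q) | ∈-map⁻ (y ∷_) p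
    ... | y′ , y′∈ys , q′ | _ , _ , refl with ∈-map⁻ (y′ ∷_) q′
    ...   | _ , _ , eq = All.lookup y∉ys y′∈ys (∷-injectiveˡ eq)

InRange : ℕ → ℕ → Set
InRange n y = 1 ≤ y × y ≤ n

∈-oneTo⁻ : ∀ n {y} → y ∈ oneTo n → InRange n y
∈-oneTo⁻ n p with x , x∈ , refl ← ∈-map⁻ suc p = s≤s z≤n , ∈-upTo⁻ x∈

∈-oneTo⁺ : ∀ n {y} → InRange n y → y ∈ oneTo n
∈-oneTo⁺ n {suc y} (_ , y<n) = ∈-map⁺ suc (∈-upTo⁺ y<n)

Unique-oneTo : ∀ n → Unique (oneTo n)
Unique-oneTo n = Unique.map⁺ suc-injective (Unique.upTo⁺ n)

length-oneTo : ∀ n → length (oneTo n) ≡ n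
length-oneTo n = trans (length-map suc (upTo n)) (length-upTo n)

DistinctWord : (ℕ → Set) → ℕ → List ℕ → Set
DistinctWord P n π = length π ≡ n × All P π × Unique π

∈-perms⁻ : ∀ n {π} → π ∈ perms n → DistinctWord (InRange n) n π
∈-perms⁻ n p with ∈-filter⁻ (T? ∘ distinct) {xs = words (oneTo n) n} p
... | π∈words , d with ∈-words⁻ (oneTo n) n π∈words
...   | len , π⊆ = len , All.map (∈-oneTo⁻ n) π⊆ , distinct⇒Unique _ d

∈-perms⁺ : ∀ n {π} → DistinctWord (InRange n) n π → π ∈ perms n
∈-perms⁺ n (refl , inRange , π!) =
  ∈-filter⁺ (T? ∘ distinct) (∈-words⁺ (oneTo _) (All.map (∈-oneTo⁺ _) inRange)) (Unique⇒distinct π!)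

Unique-perms : ∀ n → Unique (perms n)
Unique-perms n = Unique.filter⁺ (T? ∘ distinct) (Unique-words n (Unique-oneTo n))

countAvoiders-enumeration : ∀ R n {L : List (List ℕ)} → Unique L →
  (∀ {π} → π ∈ L → DistinctWord (InRange n) n π × T (avoidsAll R π)) →
  (∀ {π} → DistinctWord (InRange n) n π → T (avoidsAll R π) → π ∈ L) →
  countAvoiders R n ≡ length L
countAvoiders-enumeration R n L! sound complete =
  length-≡-unique (Unique.filter⁺ (T? ∘ avoidsAll R) (Unique-perms n)) L! to from
  where
  to : ∀ {π} → π ∈ filterᵇ (avoidsAll R) (perms n) → π ∈ _
  to p with ∈-filter⁻ (T? ∘ avoidsAll R) {xs = perms n} p
  ... | π∈perms , av = complete (∈-perms⁻ n π∈perms) av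
  from : ∀ {π} → π ∈ _ → π ∈ filterᵇ (avoidsAll R) (perms n)
  from p with word , av ← sound p = ∈-filter⁺ (T? ∘ avoidsAll R) (∈-perms⁺ n word) av

-- Pigeonhole: the entries below x are distinct elements of {1,…,x−1}, so at least two exceed x.
two-above : ∀ {x m τ} → 1 ≤ x → x < m → length τ ≡ m → Unique τ → All (λ y → 1 ≤ y × x ≢ y) τ →
            ∃₂ λ y w → (y ∷ w ∷ []) ⊆ τ × x < y × x < w
two-above {suc x} {m} {τ} _ x<m len τ! entries with pairOf above 2≤above
  where
  above rest : List ℕ
  above = filterᵇ (suc x <ᵇ_) τ
  rest  = filterᵇ (not ∘ (suc x <ᵇ_)) τ
  pairOf : (xs : List ℕ) → 2 ≤ length xs → ∃₂ λ y w → (y ∷ w ∷ []) ⊆ xs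
  pairOf (y ∷ w ∷ xs) _           = y , w , refl ∷ refl ∷ []⊆-universal xs
  pairOf (_ ∷ [])     (s≤s ())
  rest⊆oneTo : ∀ {z} → z ∈ rest → z ∈ oneTo x
  rest⊆oneTo z∈rest with z∈τ , z≯ ← ∈-filter⁻ (T? ∘ (not ∘ (suc x <ᵇ_))) {xs = τ} z∈rest =
    ∈-oneTo⁺ x (proj₁ (All.lookup entries z∈τ) ,
                ≤-pred (≤∧≢⇒< (≮⇒≥ (T-not⇒¬T z≯ ∘ <⇒<ᵇ)) (proj₂ (All.lookup entries z∈τ) ∘ sym)))
  |rest|≤x : length rest ≤ x
  |rest|≤x = ≤-trans (length-≤-unique (Unique.filter⁺ (T? ∘ (not ∘ (suc x <ᵇ_))) τ!) rest⊆oneTo)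
                     (≤-reflexive (length-oneTo x))
  2≤above : 2 ≤ length above
  2≤above = +-cancelʳ-≤ x 2 (length above) (begin
    2 + x                         ≤⟨ x<m ⟩
    m                             ≡⟨ trans (sym len) (length-filterᵇ-split (suc x <ᵇ_) τ) ⟩
    length above + length rest    ≤⟨ +-monoʳ-≤ (length above) |rest|≤x ⟩
    length above + x              ∎)
    where open ≤-Reasoning
... | y , w , yw⊆above =
  y , w , ⊆-trans yw⊆above (filter-⊆ (T? ∘ (suc x <ᵇ_)) τ) , above< (here refl) , above< (there (here refl))
  where
  above< : ∀ {z} → z ∈ y ∷ w ∷ [] → suc x < z
  above< z∈ = <ᵇ⇒< (suc x) _ (proj₂ (∈-filter⁻ (T? ∘ (suc x <ᵇ_)) {xs = τ} (Any-resp-⊆ yw⊆above z∈)))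

∈-subseqs⁻ : ∀ k π {τ} → τ ∈ subseqs k π → τ ⊆ π × length τ ≡ k
∈-subseqs⁻ zero    π        (here refl) = []⊆-universal π , refl
∈-subseqs⁻ (suc k) (x ∷ xs) p with ∈-++⁻ (map (x ∷_) (subseqs k xs)) p
... | inj₂ q = Product.map₁ (x ∷ʳ_) (∈-subseqs⁻ (suc k) xs q)
... | inj₁ q with ∈-map⁻ (x ∷_) q
...   | τ , r , refl = Product.map (refl ∷_) (cong suc) (∈-subseqs⁻ k xs r)

∈-subseqs⁺ : ∀ {τ π} → τ ⊆ π → τ ∈ subseqs (length τ) π
∈-subseqs⁺ []                   = here refl
∈-subseqs⁺ {[]}    (y ∷ʳ p)     = here refl
∈-subseqs⁺ {_ ∷ τ} (y ∷ʳ p)     = ∈-++⁺ʳ (map (y ∷_) (subseqs (length τ) _)) (∈-subseqs⁺ p)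
∈-subseqs⁺         (refl ∷ p)   = ∈-++⁺ˡ (∈-map⁺ (_ ∷_) (∈-subseqs⁺ p))

contains⁻ : ∀ σ π → T (contains σ π) →
            ∃ λ τ → τ ⊆ π × length τ ≡ length σ × T (sameOrder τ σ)
contains⁻ σ π c with τ , τ∈ , same ← find (any⁻ _ (subseqs (length σ) π) c) =
  τ , proj₁ (∈-subseqs⁻ (length σ) π τ∈) , proj₂ (∈-subseqs⁻ (length σ) π τ∈) , same

contains⁺ : ∀ σ {π} τ → τ ⊆ π → length τ ≡ length σ → T (sameOrder τ σ) → T (contains σ π)
contains⁺ σ τ τ⊆π len same = any⁺ _ (lose (subst (λ k → τ ∈ subseqs k _) len (∈-subseqs⁺ τ⊆π)) same)

-- The comparison that sameOrderPairs performs between two positions.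
agrees : ℕ → ℕ → ℕ × ℕ → Bool
agrees a s (a′ , s′) = ((a <ᵇ a′) ⇔ᵇ (s <ᵇ s′)) ∧ ((a′ <ᵇ a) ⇔ᵇ (s′ <ᵇ s))

agrees-< : ∀ {w s a d} → a < w → d < s → T (agrees w s (a , d))
agrees-< a<w d<s rewrite <ᵇ-true a<w | <ᵇ-true d<s | <ᵇ-false (<⇒≤ a<w) | <ᵇ-false (<⇒≤ d<s) = _

agrees-> : ∀ {w s a d} → w < a → s < d → T (agrees w s (a , d))
agrees-> w<a s<d rewrite <ᵇ-true w<a | <ᵇ-true s<d | <ᵇ-false (<⇒≤ w<a) | <ᵇ-false (<⇒≤ s<d) = _

agrees⇒< : ∀ {w s a d} → s < d → T (agrees w s (a , d)) → w < a
agrees⇒< {w} {s} {a} {d} s<d t rewrite <ᵇ-true s<d with w <ᵇ a in eq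
... | true = <ᵇ⇒< w a (subst T (sym eq) _)

agrees⇒> : ∀ {w s a d} → d < s → T (agrees w s (a , d)) → a < w
agrees⇒> {w} {s} {a} {d} d<s t rewrite <ᵇ-true d<s | <ᵇ-false (<⇒≤ d<s) with a <ᵇ w in eq | w <ᵇ a
... | true | false = <ᵇ⇒< a w (subst T (sym eq) _)

sameOrder-∷⁻ : ∀ {x xs s ss} → T (sameOrder (x ∷ xs) (s ∷ ss)) →
               All (T ∘ agrees x s) (zipL xs ss) × T (sameOrder xs ss)
sameOrder-∷⁻ {x} {xs} {s} {ss} t =
  let lengths , pairs = ∧-split {length xs ≡ᵇ length ss} t
      new , rest = ∧-split {all (agrees x s) (zipL xs ss)} pairs in
  all⁺ _ (zipL xs ss) new , ∧-intro lengths rest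

sameOrder-∷⁺ : ∀ {x xs s ss} → All (T ∘ agrees x s) (zipL xs ss) → T (sameOrder xs ss) →
               T (sameOrder (x ∷ xs) (s ∷ ss))
sameOrder-∷⁺ {x} {xs} {s} {ss} new t =
  let lengths , rest = ∧-split {length xs ≡ᵇ length ss} t in ∧-intro lengths (∧-intro (all⁻ _ new) rest)

zipL-++ : ∀ xs ss {ys ts} → length xs ≡ length ss → zipL (xs ++ ys) (ss ++ ts) ≡ zipL xs ss ++ zipL ys ts
zipL-++ []       []       _   = refl
zipL-++ (x ∷ xs) (s ∷ ss) len = cong ((x , s) ∷_) (zipL-++ xs ss (suc-injective len))

All-zipL : ∀ {P : ℕ × ℕ → Set} xs ys → (∀ {a d} → a ∈ xs → d ∈ ys → P (a , d)) →
           All P (zipL xs ys)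
All-zipL []       _        _ = []
All-zipL (x ∷ xs) []       _ = []
All-zipL (x ∷ xs) (y ∷ ys) h =
  h (here refl) (here refl) ∷ All-zipL xs ys (λ a∈ d∈ → h (there a∈) (there d∈))

sameOrder-++⁻ʳ : ∀ xs ss {ys ts} → length xs ≡ length ss →
                 T (sameOrder (xs ++ ys) (ss ++ ts)) → T (sameOrder ys ts)
sameOrder-++⁻ʳ []       []       _   t = t
sameOrder-++⁻ʳ (x ∷ xs) (s ∷ ss) {ys} {ts} len t =
  sameOrder-++⁻ʳ xs ss (suc-injective len) (proj₂ (sameOrder-∷⁻ {x} {xs ++ ys} {s} {ss ++ ts} t))

sameOrder-1xx⁻ : ∀ {x y w s₂ s₃} → 1 < s₂ → 1 < s₃ →
                 T (sameOrder (x ∷ y ∷ w ∷ []) (1 ∷ s₂ ∷ s₃ ∷ [])) → x < y × x < w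
sameOrder-1xx⁻ {x} {y} {w} {s₂} {s₃} 1<s₂ 1<s₃ t
  with agrees-y ∷ agrees-w ∷ [] , _ ← sameOrder-∷⁻ {x} {y ∷ w ∷ []} {1} {s₂ ∷ s₃ ∷ []} t =
  agrees⇒< 1<s₂ agrees-y , agrees⇒< 1<s₃ agrees-w

sameOrder-triple⁺ : ∀ {x y w s₁ s₂ s₃} → T (agrees x s₁ (y , s₂)) → T (agrees x s₁ (w , s₃)) →
                    T (agrees y s₂ (w , s₃)) → T (sameOrder (x ∷ y ∷ w ∷ []) (s₁ ∷ s₂ ∷ s₃ ∷ []))
sameOrder-triple⁺ {x} {y} {w} {s₁} {s₂} {s₃} xy xw yw =
  sameOrder-∷⁺ {x} {y ∷ w ∷ []} {s₁} {s₂ ∷ s₃ ∷ []} (xy ∷ xw ∷ [])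
               (sameOrder-∷⁺ {y} {w ∷ []} {s₂} {s₃ ∷ []} (yw ∷ []) _)

sameOrder-132-or-123 : ∀ {x y w} → x < y → x < w → y ≢ w →
  T (sameOrder (x ∷ y ∷ w ∷ []) (1 ∷ 3 ∷ 2 ∷ [])) ⊎ T (sameOrder (x ∷ y ∷ w ∷ []) (1 ∷ 2 ∷ 3 ∷ []))
sameOrder-132-or-123 {x} {y} {w} x<y x<w y≢w with <-cmp y w
... | tri< y<w _ _ =
  inj₂ (sameOrder-triple⁺ {x} {y} {w} {1} {2} {3} (agrees-> x<y 1<2) (agrees-> x<w 1<3) (agrees-> y<w 2<3))
  where 1<2 = n<1+n 1 ; 2<3 = n<1+n 2 ; 1<3 = <-trans 1<2 2<3
... | tri≈ _ y≡w _ = ⊥-elim (y≢w y≡w)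
... | tri> _ _ w<y =
  inj₁ (sameOrder-triple⁺ {x} {y} {w} {1} {3} {2} (agrees-> x<y 1<3) (agrees-> x<w 1<2) (agrees-< w<y 2<3))
  where 1<2 = n<1+n 1 ; 2<3 = n<1+n 2 ; 1<3 = <-trans 1<2 2<3

contains-1xx⁻ : ∀ {s₂ s₃} π → 1 < s₂ → 1 < s₃ → T (contains (1 ∷ s₂ ∷ s₃ ∷ []) π) →
                ∃ λ x → ∃₂ λ y w → (x ∷ y ∷ w ∷ []) ⊆ π × x < y × x < w
contains-1xx⁻ {s₂} {s₃} π 1<s₂ 1<s₃ c with contains⁻ (1 ∷ s₂ ∷ s₃ ∷ []) π c
... | x ∷ y ∷ w ∷ []      , s , _  , same = x , y , w , s , sameOrder-1xx⁻ 1<s₂ 1<s₃ same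
... | []                  , _ , () , _
... | _ ∷ []              , _ , () , _
... | _ ∷ _ ∷ []          , _ , () , _
... | _ ∷ _ ∷ _ ∷ _ ∷ _   , _ , () , _

splitLast3 : ∀ k (τ : List ℕ) → length τ ≡ k + 3 →
             ∃₂ λ ds e → ∃₂ λ f g → τ ≡ ds ++ e ∷ f ∷ g ∷ [] × length ds ≡ k
splitLast3 zero    (e ∷ f ∷ g ∷ []) refl = [] , e , f , g , refl , refl
splitLast3 (suc k) (x ∷ τ)          len with ds , e , f , g , refl , refl ← splitLast3 k τ (suc-injective len) =
  x ∷ ds , e , f , g , refl , refl

-- window f n k = f n + f (n ∸ 1) + ⋯, over the (at most k) indices n, n − 1, …, n − k + 1 that are ≥ 0.
window : (ℕ → ℕ) → ℕ → ℕ → ℕ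
window f n       zero    = 0
window f zero    (suc k) = f zero
window f (suc n) (suc k) = f (suc n) + window f n k

-- shift z k f n = f (n ∸ k) if k ≤ n, and z otherwise: the coefficients of xᵏ · f.
shift : ∀ {A : Set} → A → ℕ → (ℕ → A) → ℕ → A
shift z zero    f n       = f n
shift z (suc k) f zero    = z
shift z (suc k) f (suc n) = shift z k f n

shift-≤ : ∀ {A : Set} (z : A) f {k n} → k ≤ n → shift z k f n ≡ f (n ∸ k)
shift-≤ z f {zero}  {n}     _       = refl
shift-≤ z f {suc k} {suc n} (s≤s p) = shift-≤ z f p

shift-> : ∀ {A : Set} (z : A) f {k n} → n < k → shift z k f n ≡ z
shift-> z f {suc k} {zero}  _       = refl
shift-> z f {suc k} {suc n} (s≤s p) = shift-> z f p

shift-map : ∀ {A B : Set} (g : A → B) z k f n → shift (g z) k (g ∘ f) n ≡ g (shift z k f n)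
shift-map g z zero    f n       = refl
shift-map g z (suc k) f zero    = refl
shift-map g z (suc k) f (suc n) = shift-map g z k f n

window-suc : ∀ {g f} → g 0 ≡ 0 → (∀ j → g (suc j) ≡ f j) → ∀ n k → window g (suc n) k ≡ window f n k
window-suc g0 g∘suc n       zero          = refl
window-suc g0 g∘suc zero    (suc zero)    = trans (+-identityʳ _) (g∘suc 0)
window-suc g0 g∘suc zero    (suc (suc k)) = trans (cong₂ _+_ (g∘suc 0) g0) (+-identityʳ _)
window-suc g0 g∘suc (suc n) (suc k)       = cong₂ _+_ (g∘suc (suc n)) (window-suc g0 g∘suc n k)

window-+ : ∀ f g n k → window (λ j → f j + g j) n k ≡ window f n k + window g n k
window-+ f g n       zero    = refl
window-+ f g zero    (suc k) = refl
window-+ f g (suc n) (suc k) = begin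
  f (suc n) + g (suc n) + window (λ j → f j + g j) n k
    ≡⟨ cong (λ t → f (suc n) + g (suc n) + t) (window-+ f g n k) ⟩
  f (suc n) + g (suc n) + (window f n k + window g n k)
    ≡⟨ +-+-swap (f (suc n)) (g (suc n)) (window f n k) (window g n k) ⟩
  f (suc n) + window f n k + (g (suc n) + window g n k) ∎
  where
  open ≡-Reasoning
  +-+-swap : ∀ a b c d → a + b + (c + d) ≡ a + c + (b + d)
  +-+-swap = solve-∀

window-* : ∀ a f n k → window (λ j → a * f j) n k ≡ a * window f n k
window-* a f n       zero    = sym (*-zeroʳ a)
window-* a f zero    (suc k) = refl
window-* a f (suc n) (suc k) =
  trans (cong (λ t → a * f (suc n) + t) (window-* a f n k)) (sym (*-distribˡ-+ a (f (suc n)) _))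

window-cong : ∀ {f g} n k → (∀ {j} → j ≤ n → f j ≡ g j) → window f n k ≡ window g n k
window-cong n       zero    _  = refl
window-cong zero    (suc k) eq = eq z≤n
window-cong (suc n) (suc k) eq = cong₂ _+_ (eq ≤-refl) (window-cong n k (eq ∘ m≤n⇒m≤1+n))

window-widen : ∀ f n k → window f n (suc k) ≡ window f n k + shift 0 k f n
window-widen f zero    zero    = refl
window-widen f zero    (suc k) = sym (+-identityʳ (f 0))
window-widen f (suc n) zero    = +-identityʳ (f (suc n))
window-widen f (suc n) (suc k) =
  trans (cong (λ t → f (suc n) + t) (window-widen f n k)) (sym (+-assoc (f (suc n)) _ _))

window-pred : ∀ {f} → f 0 ≡ 0 → ∀ p k → window f p (suc k) ≡ f p + window f (ℕ.pred p) k
window-pred f0 (suc p) k       = refl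
window-pred f0 zero    zero    = sym (+-identityʳ _)
window-pred {f} f0 zero (suc k) = sym (trans (cong (λ t → f 0 + t) f0) (+-identityʳ (f 0)))

IsPartialSum : (ℕ → ℕ) → (ℕ → ℕ) → Set
IsPartialSum h g = h 0 ≡ g 0 × (∀ n → h (suc n) ≡ h n + g (suc n))

window+shift-partialSum : ∀ {h g} → IsPartialSum h g → ∀ n k → window g n k + shift 0 k h n ≡ h n
window+shift-partialSum ps n       zero    = refl
window+shift-partialSum ps zero    (suc k) = trans (+-identityʳ _) (sym (proj₁ ps))
window+shift-partialSum {h} {g} ps (suc n) (suc k) = begin
  g (suc n) + window g n k + shift 0 k h n   ≡⟨ +-assoc (g (suc n)) _ _ ⟩
  g (suc n) + (window g n k + shift 0 k h n) ≡⟨ cong (λ t → g (suc n) + t) (window+shift-partialSum ps n k) ⟩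
  g (suc n) + h n                            ≡⟨ +-comm (g (suc n)) (h n) ⟩
  h n + g (suc n)                            ≡⟨ proj₂ ps n ⟨
  h (suc n)                                  ∎
  where open ≡-Reasoning

shift-partialSum : ∀ {h g} → IsPartialSum h g →
                   ∀ k n → shift 0 k h n ≡ shift 0 (suc k) h n + shift 0 k g n
shift-partialSum ps zero    zero    = proj₁ ps
shift-partialSum ps zero    (suc n) = proj₂ ps n
shift-partialSum ps (suc k) zero    = refl
shift-partialSum ps (suc k) (suc n) = shift-partialSum ps k n

WindowRecurrence : ℕ → (ℕ → ℕ) → (ℕ → ℕ) → Set
WindowRecurrence k h f = ∀ n → f (suc n) ≡ window f n k + shift 0 k h n

WindowRecurrence-unique : ∀ {k h f g} → WindowRecurrence k h f → WindowRecurrence k h g → f 0 ≡ g 0 →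
                          ∀ n → f n ≡ g n
WindowRecurrence-unique {k} {h} {f} {g} rf rg f0≡g0 n = agree n ≤-refl
  where
  open ≡-Reasoning
  agree : ∀ {j} n → j ≤ n → f j ≡ g j
  agree {zero}  _       _         = f0≡g0
  agree {suc j} (suc n) (s≤s j≤n) = begin
    f (suc j)
      ≡⟨ rf j ⟩
    window f j k + shift 0 k h j
      ≡⟨ cong (_+ shift 0 k h j) (window-cong j k (λ i≤j → agree n (≤-trans i≤j j≤n))) ⟩
    window g j k + shift 0 k h j
      ≡⟨ rg j ⟨
    g (suc j) ∎

WindowRecurrence-secondOrder : ∀ {k h g f} → IsPartialSum h g → WindowRecurrence (suc k) h f →
                               ∀ n → f (2 + n) + shift 0 k f n ≡ 2 * f (1 + n) + shift 0 k g n
WindowRecurrence-secondOrder {k} {h} {g} {f} ps rec n = begin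
  f (2 + n) + shift 0 k f n
    ≡⟨ cong (_+ shift 0 k f n) (rec (suc n)) ⟩
  f (1 + n) + window f n k + shift 0 k h n + shift 0 k f n
    ≡⟨ cong (λ t → f (1 + n) + window f n k + t + shift 0 k f n) (shift-partialSum ps k n) ⟩
  f (1 + n) + window f n k + (shift 0 (suc k) h n + shift 0 k g n) + shift 0 k f n
    ≡⟨ regroup (f (1 + n)) (window f n k) (shift 0 (suc k) h n) (shift 0 k g n) (shift 0 k f n) ⟩
  f (1 + n) + (window f n k + shift 0 k f n + shift 0 (suc k) h n) + shift 0 k g n
    ≡⟨ cong (λ t → f (1 + n) + (t + shift 0 (suc k) h n) + shift 0 k g n) (window-widen f n k) ⟨
  f (1 + n) + (window f n (suc k) + shift 0 (suc k) h n) + shift 0 k g n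
    ≡⟨ cong (λ t → f (1 + n) + t + shift 0 k g n) (rec n) ⟨
  f (1 + n) + f (1 + n) + shift 0 k g n
    ≡⟨ cong (λ t → f (1 + n) + t + shift 0 k g n) (+-identityʳ (f (1 + n))) ⟨
  2 * f (1 + n) + shift 0 k g n
    ∎
  where
  open ≡-Reasoning
  regroup : ∀ a w s t x → a + w + (s + t) + x ≡ a + (w + x + s) + t
  regroup = solve-∀

sum-take-fibHist : ∀ k n j → sum (take j (fibHist k (suc n))) ≡ window (F k ∘ suc) n j
sum-take-fibHist k n       zero          = refl
sum-take-fibHist k zero    (suc zero)    = refl
sum-take-fibHist k zero    (suc (suc j)) = refl
sum-take-fibHist k (suc n) (suc j)       = cong (λ t → F k (2 + n) + t) (sum-take-fibHist k n j)

F-rec : ∀ k n → F k (2 + n) ≡ window (F k ∘ suc) n k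
F-rec k n = sum-take-fibHist k n k

fibSum : ℕ → ℕ → ℕ
fibSum k n = sumℕ 1 n (F k)

fibSum-suc : ∀ k n → fibSum k (suc n) ≡ fibSum k n + F k (suc n)
fibSum-suc k n = begin
  sum (map (F k) (map (λ j → 1 + j) (upTo (suc n))))
    ≡⟨ cong sum (map-∘ {g = F k} {f = λ j → 1 + j} (upTo (suc n))) ⟨
  sum (map (F k ∘ suc) (upTo (suc n)))
    ≡⟨ cong (sum ∘ map (F k ∘ suc)) (upTo-∷ʳ n) ⟨
  sum (map (F k ∘ suc) (upTo n ++ n ∷ []))
    ≡⟨ cong sum (map-++ (F k ∘ suc) (upTo n) (n ∷ [])) ⟩
  sum (map (F k ∘ suc) (upTo n) ++ F k (suc n) ∷ [])
    ≡⟨ sum-++ (map (F k ∘ suc) (upTo n)) (F k (suc n) ∷ []) ⟩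
  sum (map (F k ∘ suc) (upTo n)) + (F k (suc n) + 0)
    ≡⟨ cong₂ _+_ (cong sum (map-∘ {g = F k} {f = λ j → 1 + j} (upTo n))) (+-identityʳ (F k (suc n))) ⟩
  fibSum k n + F k (suc n) ∎
  where open ≡-Reasoning

fibSum-rec : ∀ k n → fibSum k (suc n) ≡ 1 + window (fibSum k) n k
fibSum-rec zero    zero = refl
fibSum-rec (suc k) zero = refl
fibSum-rec k (suc n) = begin
  fibSum k (2 + n)
    ≡⟨ fibSum-suc k (suc n) ⟩
  fibSum k (suc n) + F k (2 + n)
    ≡⟨ cong₂ _+_ (fibSum-rec k n) (F-rec k n) ⟩
  1 + window (fibSum k) n k + window (F k ∘ suc) n k
    ≡⟨ +-assoc 1 (window (fibSum k) n k) (window (F k ∘ suc) n k) ⟩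
  1 + (window (fibSum k) n k + window (F k ∘ suc) n k)
    ≡⟨ cong suc (window-+ (fibSum k) (F k ∘ suc) n k) ⟨
  1 + window (λ j → fibSum k j + F k (suc j)) n k
    ≡⟨ cong suc (window-suc refl (fibSum-suc k) n k) ⟨
  1 + window (fibSum k) (suc n) k ∎
  where open ≡-Reasoning

Σ< : (ℕ → ℤ) → ℕ → ℤ
Σ< h n = foldr ℤ._+_ (+ 0) (map h (upTo n))

Σ<-suc : ∀ h n → Σ< h (suc n) ≡ Σ< h n ℤ.+ h n
Σ<-suc h n = begin
  foldr ℤ._+_ (+ 0) (map h (upTo (suc n)))
    ≡⟨ cong (foldr ℤ._+_ (+ 0) ∘ map h) (upTo-∷ʳ n) ⟨
  foldr ℤ._+_ (+ 0) (map h (upTo n ++ n ∷ []))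
    ≡⟨ cong (foldr ℤ._+_ (+ 0)) (map-++ h (upTo n) (n ∷ [])) ⟩
  foldr ℤ._+_ (+ 0) (map h (upTo n) ++ h n ∷ [])
    ≡⟨ foldr-++ ℤ._+_ (+ 0) (map h (upTo n)) (h n ∷ []) ⟩
  foldr ℤ._+_ (h n ℤ.+ + 0) (map h (upTo n))
    ≡⟨ cong (λ z → foldr ℤ._+_ z (map h (upTo n))) (ℤP.+-identityʳ (h n)) ⟩
  foldr ℤ._+_ (h n) (map h (upTo n))
    ≡⟨ foldr-init (map h (upTo n)) ⟩
  Σ< h n ℤ.+ h n ∎
  where
  open ≡-Reasoning
  foldr-init : ∀ {z} xs → foldr ℤ._+_ z xs ≡ foldr ℤ._+_ (+ 0) xs ℤ.+ z
  foldr-init {z} []       = sym (ℤP.+-identityˡ z)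
  foldr-init {z} (x ∷ xs) = trans (cong (λ t → x ℤ.+ t) (foldr-init xs)) (sym (ℤP.+-assoc x _ z))

Σ<-cong : ∀ {h g} n → (∀ i → h i ≡ g i) → Σ< h n ≡ Σ< g n
Σ<-cong n eq = cong (foldr ℤ._+_ (+ 0)) (map-cong eq (upTo n))

Σ<-+ : ∀ h g n → Σ< (λ i → h i ℤ.+ g i) n ≡ Σ< h n ℤ.+ Σ< g n
Σ<-+ h g zero    = refl
Σ<-+ h g (suc n) = begin
  Σ< (λ i → h i ℤ.+ g i) (suc n)            ≡⟨ Σ<-suc (λ i → h i ℤ.+ g i) n ⟩
  Σ< (λ i → h i ℤ.+ g i) n ℤ.+ (h n ℤ.+ g n) ≡⟨ cong (ℤ._+ (h n ℤ.+ g n)) (Σ<-+ h g n) ⟩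
  Σ< h n ℤ.+ Σ< g n ℤ.+ (h n ℤ.+ g n)       ≡⟨ swap (Σ< h n) (Σ< g n) (h n) (g n) ⟩
  (Σ< h n ℤ.+ h n) ℤ.+ (Σ< g n ℤ.+ g n)     ≡⟨ cong₂ ℤ._+_ (Σ<-suc h n) (Σ<-suc g n) ⟨
  Σ< h (suc n) ℤ.+ Σ< g (suc n)             ∎
  where
  open ≡-Reasoning
  swap : ∀ a b c d → a ℤ.+ b ℤ.+ (c ℤ.+ d) ≡ a ℤ.+ c ℤ.+ (b ℤ.+ d)
  swap = ℤ-solve-∀

Σ<-zero : ∀ {h} n → (∀ {i} → i < n → h i ≡ + 0) → Σ< h n ≡ + 0
Σ<-zero zero    _    = refl
Σ<-zero {h} (suc n) vanish =
  trans (Σ<-suc h n) (cong₂ ℤ._+_ (Σ<-zero n (vanish ∘ m<n⇒m<1+n)) (vanish (n<1+n n)))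

Σ<-single : ∀ {h j} n → j < n → (∀ {i} → i < n → i ≢ j → h i ≡ + 0) → Σ< h n ≡ h j
Σ<-single {h} {j} (suc n) j<1+n vanish with m≤n⇒m<n∨m≡n (≤-pred j<1+n)
... | inj₁ j<n  = begin
  Σ< h (suc n)
    ≡⟨ Σ<-suc h n ⟩
  Σ< h n ℤ.+ h n
    ≡⟨ cong₂ ℤ._+_ (Σ<-single n j<n (vanish ∘ m<n⇒m<1+n)) (vanish (n<1+n n) (λ n≡j → <-irrefl (sym n≡j) j<n)) ⟩
  h j ℤ.+ + 0
    ≡⟨ ℤP.+-identityʳ (h j) ⟩
  h j ∎
  where open ≡-Reasoning
... | inj₂ refl = begin
  Σ< h (suc n)
    ≡⟨ Σ<-suc h n ⟩
  Σ< h n ℤ.+ h n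
    ≡⟨ cong (ℤ._+ h n) (Σ<-zero n (λ i<n → vanish (m<n⇒m<1+n i<n) (λ { refl → <-irrefl refl i<n }))) ⟩
  + 0 ℤ.+ h n
    ≡⟨ ℤP.+-identityˡ (h n) ⟩
  h n ∎
  where open ≡-Reasoning

sumℤ-from-0 : ∀ h m → sumℤ 0 m h ≡ Σ< h (suc m)
sumℤ-from-0 h m = cong (foldr ℤ._+_ (+ 0))
  (trans (sym (map-∘ {g = h} {f = λ j → 0 + j} (upTo (suc m)))) (map-cong (λ _ → refl) (upTo (suc m))))

⊗-congˡ : ∀ {f g} h m → (∀ i → f i ≡ g i) → (f ⊗ h) m ≡ (g ⊗ h) m
⊗-congˡ {f} {g} h m eq =
  trans (sumℤ-from-0 (λ i → f i ℤ.* h (m ∸ i)) m)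
        (trans (Σ<-cong (suc m) (λ i → cong (ℤ._* h (m ∸ i)) (eq i)))
               (sym (sumℤ-from-0 (λ i → g i ℤ.* h (m ∸ i)) m)))

⊗-distribˡ-⊕ : ∀ f g h m → (f ⊗ (g ⊕ h)) m ≡ (f ⊗ g) m ℤ.+ (f ⊗ h) m
⊗-distribˡ-⊕ f g h m = begin
  (f ⊗ (g ⊕ h)) m
    ≡⟨ sumℤ-from-0 (λ i → f i ℤ.* (g (m ∸ i) ℤ.+ h (m ∸ i))) m ⟩
  Σ< (λ i → f i ℤ.* (g (m ∸ i) ℤ.+ h (m ∸ i))) (suc m)
    ≡⟨ Σ<-cong (suc m) (λ i → ℤP.*-distribˡ-+ (f i) _ _) ⟩
  Σ< (λ i → f i ℤ.* g (m ∸ i) ℤ.+ f i ℤ.* h (m ∸ i)) (suc m)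
    ≡⟨ Σ<-+ (λ i → f i ℤ.* g (m ∸ i)) (λ i → f i ℤ.* h (m ∸ i)) (suc m) ⟩
  Σ< (λ i → f i ℤ.* g (m ∸ i)) (suc m) ℤ.+ Σ< (λ i → f i ℤ.* h (m ∸ i)) (suc m)
                      ≡⟨ cong₂ ℤ._+_ (sumℤ-from-0 (λ i → f i ℤ.* g (m ∸ i)) m) (sumℤ-from-0 (λ i → f i ℤ.* h (m ∸ i)) m) ⟨
  (f ⊗ g) m ℤ.+ (f ⊗ h) m ∎
  where open ≡-Reasoning

mono-≡ : ∀ c k → mono c k k ≡ c
mono-≡ c k rewrite ≡ᵇ-refl k = refl

mono-≢ : ∀ c {k j} → j ≢ k → mono c k j ≡ + 0
mono-≢ c j≢k rewrite ≡ᵇ-false j≢k = refl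

⊗-mono : ∀ f c k m → (f ⊗ mono c k) m ≡ shift (+ 0) k f m ℤ.* c
⊗-mono f c k m with k ≤? m
... | yes k≤m = begin
  (f ⊗ mono c k) m
    ≡⟨ sumℤ-from-0 (λ i → f i ℤ.* mono c k (m ∸ i)) m ⟩
  Σ< (λ i → f i ℤ.* mono c k (m ∸ i)) (suc m)
    ≡⟨ Σ<-single (suc m) (s≤s (m∸n≤m m k)) off-diagonal ⟩
  f (m ∸ k) ℤ.* mono c k (m ∸ (m ∸ k))
    ≡⟨ cong (λ t → f (m ∸ k) ℤ.* t) (trans (cong (mono c k) (m∸[m∸n]≡n k≤m)) (mono-≡ c k)) ⟩
  f (m ∸ k) ℤ.* c
    ≡⟨ cong (ℤ._* c) (shift-≤ (+ 0) f k≤m) ⟨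
  shift (+ 0) k f m ℤ.* c ∎
  where
  open ≡-Reasoning
  off-diagonal : ∀ {i} → i < suc m → i ≢ m ∸ k → f i ℤ.* mono c k (m ∸ i) ≡ + 0
  off-diagonal {i} i≤m i≢ =
    trans (cong (λ t → f i ℤ.* t) (mono-≢ c (λ m∸i≡k → i≢ (sym (∸-inverse (≤-pred i≤m) m∸i≡k)))))
          (ℤP.*-zeroʳ (f i))
    where
    ∸-inverse : ∀ {i} → i ≤ m → m ∸ i ≡ k → m ∸ k ≡ i
    ∸-inverse i≤m refl = m∸[m∸n]≡n i≤m
... | no k≰m = begin
  (f ⊗ mono c k) m
    ≡⟨ sumℤ-from-0 (λ i → f i ℤ.* mono c k (m ∸ i)) m ⟩
  Σ< (λ i → f i ℤ.* mono c k (m ∸ i)) (suc m)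
    ≡⟨ Σ<-zero (suc m) (λ {i} _ → trans (cong (λ t → f i ℤ.* t) (mono-≢ c (m∸i≢k i))) (ℤP.*-zeroʳ (f i))) ⟩
  + 0
    ≡⟨ ℤP.*-zeroˡ c ⟨
  + 0 ℤ.* c
    ≡⟨ cong (ℤ._* c) (shift-> (+ 0) f (≰⇒> k≰m)) ⟨
  shift (+ 0) k f m ℤ.* c ∎
  where
  open ≡-Reasoning
  m∸i≢k : ∀ i → m ∸ i ≢ k
  m∸i≢k i m∸i≡k = k≰m (subst (_≤ m) m∸i≡k (m∸n≤m m i))

second-difference-ℤ : ∀ g₂ g₁ g₀ i → g₂ + g₀ ≡ 2 * g₁ + i →
                      + g₂ ℤ.* + 1 ℤ.+ + g₁ ℤ.* ℤ.- (+ 2) ℤ.+ + g₀ ℤ.* + 1 ≡ + i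
second-difference-ℤ g₂ g₁ g₀ i eq = begin
  + g₂ ℤ.* + 1 ℤ.+ + g₁ ℤ.* ℤ.- (+ 2) ℤ.+ + g₀ ℤ.* + 1
    ≡⟨ regroup (+ g₂) (+ g₁) (+ g₀) ⟩
  (+ g₂ ℤ.+ + g₀) ℤ.- + 2 ℤ.* + g₁
    ≡⟨ cong (λ z → + z ℤ.- + 2 ℤ.* + g₁) eq ⟩
  + (2 * g₁) ℤ.+ + i ℤ.- + 2 ℤ.* + g₁
    ≡⟨ cong (λ z → z ℤ.+ + i ℤ.- + 2 ℤ.* + g₁) (ℤP.pos-* 2 g₁) ⟩
  + 2 ℤ.* + g₁ ℤ.+ + i ℤ.- + 2 ℤ.* + g₁
    ≡⟨ cancel (+ g₁) (+ i) ⟩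
  + i ∎
  where
  open ≡-Reasoning
  regroup : ∀ a g x → a ℤ.* + 1 ℤ.+ g ℤ.* ℤ.- (+ 2) ℤ.+ x ℤ.* + 1 ≡ (a ℤ.+ x) ℤ.- + 2 ℤ.* g
  regroup = ℤ-solve-∀
  cancel : ∀ g i → + 2 ℤ.* g ℤ.+ i ℤ.- + 2 ℤ.* g ≡ i
  cancel = ℤ-solve-∀

HasDescent NoDescent : List ℕ → Set
HasDescent π = ∃₂ λ f g → (f ∷ g ∷ []) ⊆ π × g < f
NoDescent π = ¬ HasDescent π

Decreasing : List ℕ → Set
Decreasing = AllPairs _>_

ascendingAvoiders : ℕ → List (List ℕ)
ascendingAvoiders zero                = [] ∷ []
ascendingAvoiders (suc zero)          = (1 ∷ []) ∷ []
ascendingAvoiders (suc (suc zero))    = (1 ∷ 2 ∷ []) ∷ []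
ascendingAvoiders (suc (suc (suc _))) = []

#ascending : ℕ → ℕ
#ascending m = length (ascendingAvoiders m)

ascending-shape : ∀ m {π} → π ∈ ascendingAvoiders m → DistinctWord (InRange m) m π
ascending-shape zero             (here refl) = refl , [] , []
ascending-shape (suc zero)       (here refl) = refl , (s≤s z≤n , s≤s z≤n) ∷ [] , [] ∷ []
ascending-shape (suc (suc zero)) (here refl) =
  refl , (s≤s z≤n , s≤s z≤n) ∷ (s≤s z≤n , s≤s (s≤s z≤n)) ∷ [] , ((λ ()) ∷ []) ∷ [] ∷ []

ascending-length≤2 : ∀ m {π} → π ∈ ascendingAvoiders m → length π ≤ 2
ascending-length≤2 zero             (here refl) = z≤n
ascending-length≤2 (suc zero)       (here refl) = s≤s z≤n
ascending-length≤2 (suc (suc zero)) (here refl) = s≤s (s≤s z≤n)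

ascending-noDescent : ∀ m {π} → π ∈ ascendingAvoiders m → NoDescent π
ascending-noDescent zero             (here refl) (_ , _ , () , _)
ascending-noDescent (suc zero)       (here refl) (_ , _ , _ ∷ʳ () , _)
ascending-noDescent (suc zero)       (here refl) (_ , _ , refl ∷ () , _)
ascending-noDescent (suc (suc zero)) (here refl) (_ , _ , refl ∷ refl ∷ [] , s≤s ())
ascending-noDescent (suc (suc zero)) (here refl) (_ , _ , refl ∷ _ ∷ʳ () , _)
ascending-noDescent (suc (suc zero)) (here refl) (_ , _ , _ ∷ʳ refl ∷ () , _)
ascending-noDescent (suc (suc zero)) (here refl) (_ , _ , _ ∷ʳ _ ∷ʳ () , _)

Unique-ascending : ∀ m → Unique (ascendingAvoiders m)
Unique-ascending zero                = [] ∷ []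
Unique-ascending (suc zero)          = [] ∷ []
Unique-ascending (suc (suc zero))    = [] ∷ []
Unique-ascending (suc (suc (suc _))) = []

#ascending≤ : ℕ → ℕ
#ascending≤ zero    = #ascending zero
#ascending≤ (suc n) = #ascending≤ n + #ascending (suc n)

#ascending≤-partialSum : IsPartialSum #ascending≤ #ascending
#ascending≤-partialSum = refl , λ _ → refl

#ascending≤-saturated : ∀ n → #ascending≤ (2 + n) ≡ 3
#ascending≤-saturated zero    = refl
#ascending≤-saturated (suc n) = trans (+-identityʳ _) (#ascending≤-saturated n)

module Counting (c : ℕ) where

  b : ℕ
  b = 3 + c

  truncatedGamma : ℕ → List ℕ
  truncatedGamma k = applyDownFrom (_+ 3) k ++ b + 3 ∷ 2 ∷ 1 ∷ []

  gamma≡truncatedGamma : gamma b ≡ truncatedGamma b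
  gamma≡truncatedGamma =
    cong (_++ b + 3 ∷ 2 ∷ 1 ∷ []) (trans (cong reverse (map-upTo (_+ 3) b)) (reverse-applyUpTo (_+ 3) b))

  gamma-occurrence⁻ : ∀ {x ds e f g} → length ds ≡ 2 + c →
                      T (sameOrder (x ∷ ds ++ e ∷ f ∷ g ∷ []) (gamma b)) → x < e × g < f
  gamma-occurrence⁻ {x} {ds} {e} {f} {g} len t = x<e , g<f
    where
    prefix : List ℕ
    prefix = applyDownFrom (_+ 3) (2 + c)
    len′ : length ds ≡ length prefix
    len′ = trans len (sym (length-applyDownFrom (_+ 3) (2 + c)))
    split : All (T ∘ agrees x (2 + c + 3)) (zipL (ds ++ e ∷ f ∷ g ∷ []) (prefix ++ b + 3 ∷ 2 ∷ 1 ∷ []))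
          × T (sameOrder (ds ++ e ∷ f ∷ g ∷ []) (prefix ++ b + 3 ∷ 2 ∷ 1 ∷ []))
    split = sameOrder-∷⁻ {x} {ds ++ e ∷ f ∷ g ∷ []}
                         (subst (T ∘ sameOrder (x ∷ ds ++ e ∷ f ∷ g ∷ [])) gamma≡truncatedGamma t)
    x<e : x < e
    x<e = agrees⇒< (+-monoˡ-< 3 (n<1+n (2 + c)))
            (All.head (++⁻ʳ (zipL ds prefix) (subst (All _) (zipL-++ ds prefix len′) (proj₁ split))))
    efg : T (sameOrder (e ∷ f ∷ g ∷ []) (b + 3 ∷ 2 ∷ 1 ∷ []))
    efg = sameOrder-++⁻ʳ ds prefix len′ (proj₂ split)
    g<f : g < f
    g<f = agrees⇒> (n<1+n 1)
            (All.head (proj₁ (sameOrder-∷⁻ {f} {g ∷ []} {2} {1 ∷ []}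
                                           (proj₂ (sameOrder-∷⁻ {e} {f ∷ g ∷ []} {b + 3} {2 ∷ 1 ∷ []} efg)))))

  truncatedGamma-occurrence : ∀ {W N f g} → length W ≤ b → Decreasing W → All (λ w → f < w × w < N) W →
                              f < N → g < f →
                              T (sameOrder (W ++ N ∷ f ∷ g ∷ []) (truncatedGamma (length W)))
  truncatedGamma-occurrence {[]} {N} {f} {g} _ [] [] f<N g<f =
    sameOrder-triple⁺ {N} {f} {g} {b + 3} {2} {1}
      (agrees-< f<N 2<b+3) (agrees-< (<-trans g<f f<N) (<-trans (n<1+n 1) 2<b+3)) (agrees-< g<f (n<1+n 1))
    where
    2<b+3 : 2 < b + 3
    2<b+3 = s≤s (s≤s (s≤s z≤n))
  truncatedGamma-occurrence {w ∷ W} {N} {f} {g} k<b (w>W ∷ W↓) ((f<w , w<N) ∷ between) f<N g<f =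
    sameOrder-∷⁺ {w} {W ++ N ∷ f ∷ g ∷ []} {k + 3} {truncatedGamma k} agreements
                 (truncatedGamma-occurrence (<⇒≤ k<b) W↓ between f<N g<f)
    where
    k = length W
    3≤k+3 : 3 ≤ k + 3
    3≤k+3 = m≤n+m 3 k
    agreements : All (T ∘ agrees w (k + 3)) (zipL (W ++ N ∷ f ∷ g ∷ []) (truncatedGamma k))
    agreements = subst (All _) (sym (zipL-++ W (applyDownFrom (_+ 3) k) (sym (length-applyDownFrom (_+ 3) k))))
      (All.++⁺ (All-zipL W (applyDownFrom (_+ 3) k) below)
               (agrees-> w<N (+-monoˡ-< 3 k<b) ∷ agrees-< f<w (≤-trans (s≤s (s≤s (s≤s z≤n))) 3≤k+3)
                ∷ agrees-< (<-trans g<f f<w) (≤-trans (s≤s (s≤s z≤n)) 3≤k+3) ∷ []))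
      where
      below : ∀ {a d} → a ∈ W → d ∈ applyDownFrom (_+ 3) k → T (agrees w (k + 3) (a , d))
      below a∈W d∈ with ∈-applyDownFrom⁻ (_+ 3) d∈
      ... | i , i<k , refl = agrees-< (All.lookup w>W a∈W) (+-monoˡ-< 3 i<k)

  gamma-occurrence⁺ : ∀ {W N f g} → length W ≡ b → Decreasing W → All (λ w → f < w × w < N) W →
                      f < N → g < f →
                      T (sameOrder (W ++ N ∷ f ∷ g ∷ []) (gamma b))
  gamma-occurrence⁺ {W} {N} {f} {g} len W↓ between f<N g<f =
    subst (T ∘ sameOrder (W ++ N ∷ f ∷ g ∷ [])) (trans (cong truncatedGamma len) (sym gamma≡truncatedGamma))
          (truncatedGamma-occurrence (≤-reflexive len) W↓ between f<N g<f)

  -- topRun m N k lists the avoiders over {1,…,m} ∪ {N} (m < N) of the form m, m−1, …, j+1, N, τ;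
  -- k counts the run entries still needed before a descent in τ would complete an occurrence of γ.
  mutual
    avoiders : ℕ → List (List ℕ)
    avoiders zero    = [] ∷ []
    avoiders (suc m) = topRun m (suc m) b

    topRun : ℕ → ℕ → ℕ → List (List ℕ)
    topRun m N k = map (N ∷_) (afterTop k m) ++ runStep m N k

    afterTop : ℕ → ℕ → List (List ℕ)
    afterTop zero    m = ascendingAvoiders m
    afterTop (suc k) m = avoiders m

    runStep : ℕ → ℕ → ℕ → List (List ℕ)
    runStep zero    N k = []
    runStep (suc m) N k = map (suc m ∷_) (topRun m N (ℕ.pred k))

  data TopRunView (N k : ℕ) : ℕ → List ℕ → Set where
    top : ∀ {m τ} → τ ∈ afterTop k m → TopRunView N k m (N ∷ τ)
    run : ∀ {m τ} → τ ∈ topRun m N (ℕ.pred k) → TopRunView N k (suc m) (suc m ∷ τ)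

  topRun-view : ∀ m {N k π} → π ∈ topRun m N k → TopRunView N k m π
  topRun-view m {N} {k} p with ∈-++⁻ (map (N ∷_) (afterTop k m)) p
  ... | inj₁ q with ∈-map⁻ (N ∷_) q
  ...   | _ , τ∈ , refl = top τ∈
  topRun-view (suc m) p | inj₂ q with ∈-map⁻ (suc m ∷_) q
  ...   | _ , τ∈ , refl = run τ∈

  mutual
    avoiders-shape : ∀ m {π} → π ∈ avoiders m → DistinctWord (InRange m) m π
    avoiders-shape zero    (here refl) = refl , [] , []
    avoiders-shape (suc m) p with len , inRange , π! ← topRun-shape m (n<1+n m) p =
      len , All.map widen inRange , π!
      where
      widen : ∀ {y} → InRange m y ⊎ y ≡ suc m → InRange (suc m) y
      widen (inj₁ (1≤y , y≤m)) = 1≤y , m≤n⇒m≤1+n y≤m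
      widen (inj₂ refl)        = s≤s z≤n , ≤-refl

    afterTop-shape : ∀ k m {π} → π ∈ afterTop k m → DistinctWord (InRange m) m π
    afterTop-shape zero    m p = ascending-shape m p
    afterTop-shape (suc k) m p = avoiders-shape m p

    topRun-shape : ∀ m {N k π} → m < N → π ∈ topRun m N k →
                   DistinctWord (λ y → InRange m y ⊎ y ≡ N) (suc m) π
    topRun-shape m {N} {k} m<N p with topRun-view m p
    ... | top τ∈ with len , inRange , τ! ← afterTop-shape k m τ∈ =
      cong suc len , inj₂ refl ∷ All.map inj₁ inRange , All.map N≢ inRange ∷ τ!
      where
      N≢ : ∀ {y} → InRange m y → N ≢ y
      N≢ (_ , y≤m) refl = <-irrefl refl (≤-<-trans y≤m m<N)
    topRun-shape (suc m) {N} m<N p | run τ∈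
      with len , inRange , τ! ← topRun-shape m (<-trans (n<1+n m) m<N) τ∈ =
      cong suc len , inj₁ (s≤s z≤n , ≤-refl) ∷ All.map widen inRange , All.map 1+m≢ inRange ∷ τ!
      where
      widen : ∀ {y} → InRange m y ⊎ y ≡ N → InRange (suc m) y ⊎ y ≡ N
      widen (inj₁ (1≤y , y≤m)) = inj₁ (1≤y , m≤n⇒m≤1+n y≤m)
      widen (inj₂ y≡N)         = inj₂ y≡N
      1+m≢ : ∀ {y} → InRange m y ⊎ y ≡ N → suc m ≢ y
      1+m≢ (inj₁ (_ , y≤m)) refl = <-irrefl refl y≤m
      1+m≢ (inj₂ refl)      refl = <-irrefl refl m<N

  -- NoGamma is the absence of γ itself (gamma-occurrence⁺); NoWeakGamma forbids the coarser
  -- shape that every occurrence of γ has (gamma-occurrence⁻).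
  Avoids1xx NoWeakGamma NoGamma : List ℕ → Set
  Avoids1xx π = ∀ {x y w} → (x ∷ y ∷ w ∷ []) ⊆ π → x < y → x < w → ⊥
  NoWeakGamma π = ∀ {x ds e f g} → (x ∷ ds ++ e ∷ f ∷ g ∷ []) ⊆ π → length ds ≡ 2 + c → x < e → g < f → ⊥
  NoGamma π = ∀ {W N f g} → (W ++ N ∷ f ∷ g ∷ []) ⊆ π → length W ≡ b → Decreasing W →
              All (λ w → f < w × w < N) W → f < N → g < f → ⊥

  Avoids1xx-∷ : ∀ {z π} → Avoids1xx π → (∀ {y w} → (y ∷ w ∷ []) ⊆ π → z < y → z < w → ⊥) →
                Avoids1xx (z ∷ π)
  Avoids1xx-∷ av new (_ ∷ʳ s)   = av s
  Avoids1xx-∷ av new (refl ∷ s) = new s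

  NoWeakGamma-∷ : ∀ {z π} → NoWeakGamma π →
                  (∀ {ds e f g} → (ds ++ e ∷ f ∷ g ∷ []) ⊆ π → length ds ≡ 2 + c → z < e → g < f → ⊥) →
                  NoWeakGamma (z ∷ π)
  NoWeakGamma-∷ av new (_ ∷ʳ s)   = av s
  NoWeakGamma-∷ av new (refl ∷ s) = new s

  NoGamma-mono : ∀ {π π′} → π ⊆ π′ → NoGamma π′ → NoGamma π
  NoGamma-mono π⊆π′ av s = av (⊆-trans s π⊆π′)

  short-sound : ∀ {π} → length π ≤ 2 → Avoids1xx π × NoWeakGamma π
  short-sound len≤2 = (λ s _ _ → <-irrefl refl (≤-trans (length-mono-≤ s) len≤2))
                    , (λ {x} {ds} {e} {f} {g} s _ _ _ →
                         <-irrefl refl (≤-trans (≤-trans (3≤ {x} {e} {f} {g} ds) (length-mono-≤ s)) len≤2))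
    where
    3≤ : ∀ {x e f g} ds → 3 ≤ length (x ∷ ds ++ e ∷ f ∷ g ∷ [])
    3≤ []       = s≤s (s≤s (s≤s z≤n))
    3≤ {e = e} {f} {g} (d ∷ ds) = m≤n⇒m≤1+n (3≤ {d} {e} {f} {g} ds)

  atMostOneAbove : ∀ {m N n π y w} → DistinctWord (λ y → InRange m y ⊎ y ≡ N) n π → (y ∷ w ∷ []) ⊆ π →
                   y ≤ m ⊎ w ≤ m
  atMostOneAbove {π = π} (_ , inRange , π!) s
    with All.lookup inRange (Any-resp-⊆ s (here refl)) | All.lookup inRange (Any-resp-⊆ s (there (here refl)))
  ... | inj₁ (_ , y≤m) | _              = inj₁ y≤m
  ... | inj₂ _         | inj₁ (_ , w≤m) = inj₂ w≤m
  ... | inj₂ refl      | inj₂ refl      = ⊥-elim (Unique-pair π! s refl)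

  afterTop-noDescent : ∀ {k} m {π} → k ≤ 0 → π ∈ afterTop k m → NoDescent π
  afterTop-noDescent {zero} m _ = ascending-noDescent m

  topRun-noLateDescent : ∀ m {N k π} → m < N → π ∈ topRun m N k →
                         ∀ {ds e f g} → (ds ++ e ∷ f ∷ g ∷ []) ⊆ π → m < e → k ≤ length ds → g < f → ⊥
  topRun-noLateDescent m {N} {k} m<N p with topRun-view m p
  ... | top {τ = τ} τ∈ = late
    where
    notInτ : ∀ {e} → e ∈ τ → m < e → ⊥
    notInτ e∈τ m<e =
      <-irrefl refl (<-≤-trans m<e (proj₂ (All.lookup (proj₁ (proj₂ (afterTop-shape k m τ∈))) e∈τ)))
    late : ∀ {ds e f g} → (ds ++ e ∷ f ∷ g ∷ []) ⊆ N ∷ τ → m < e → k ≤ length ds → g < f → ⊥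
    late {[]}     (_ ∷ʳ s)   m<e _   _   = notInτ (Any-resp-⊆ s (here refl)) m<e
    late {[]} {f = f} {g} (refl ∷ s) _ k≤0 g<f = afterTop-noDescent m k≤0 τ∈ (f , g , s , g<f)
    late {d ∷ ds} s          m<e _   _   = notInτ (Any-resp-⊆ (∷⁻ s) (∈-++⁺ʳ ds (here refl))) m<e
  topRun-noLateDescent (suc m) {N} {k} m<N p | run {τ = τ} τ∈ = late
    where
    continue : ∀ {ds e f g} → (ds ++ e ∷ f ∷ g ∷ []) ⊆ τ → suc m < e → ℕ.pred k ≤ length ds → g < f → ⊥
    continue s 1+m<e = topRun-noLateDescent m (<-trans (n<1+n m) m<N) τ∈ s (<-trans (n<1+n m) 1+m<e)
    late : ∀ {ds e f g} → (ds ++ e ∷ f ∷ g ∷ []) ⊆ suc m ∷ τ → suc m < e → k ≤ length ds → g < f → ⊥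
    late {[]}    (_ ∷ʳ s)   1+m<e k≤  = continue {[]} s 1+m<e (≤-trans pred[n]≤n k≤)
    late {[]}    (refl ∷ s) 1+m<e _ _ = <-irrefl refl 1+m<e
    late {_ ∷ _} (_ ∷ʳ s)   1+m<e k≤  = continue s 1+m<e (≤-trans pred[n]≤n k≤)
    late {_ ∷ _} (refl ∷ s) 1+m<e k≤  = continue s 1+m<e (pred-mono-≤ k≤)

  mutual
    avoiders-sound : ∀ m {π} → π ∈ avoiders m → Avoids1xx π × NoWeakGamma π
    avoiders-sound zero    (here refl) = short-sound z≤n
    avoiders-sound (suc m) p           = topRun-sound m (n<1+n m) ≤-refl p

    afterTop-sound : ∀ k m {π} → π ∈ afterTop k m → Avoids1xx π × NoWeakGamma π
    afterTop-sound zero    m p = short-sound (ascending-length≤2 m p)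
    afterTop-sound (suc k) m p = avoiders-sound m p

    topRun-sound : ∀ m {N k π} → m < N → k ≤ b → π ∈ topRun m N k → Avoids1xx π × NoWeakGamma π
    topRun-sound m {N} {k} m<N k≤b p with topRun-view m p
    ... | top {τ = τ} τ∈ =
      Avoids1xx-∷ (proj₁ rest) (λ s N<y _ → notAbove (Any-resp-⊆ s (here refl)) N<y) ,
      NoWeakGamma-∷ (proj₂ rest)
                    (λ {ds} s _ N<e _ → notAbove (Any-resp-⊆ s (∈-++⁺ʳ ds (here refl))) N<e)
      where
      rest = afterTop-sound k m τ∈
      notAbove : ∀ {y} → y ∈ τ → N < y → ⊥
      notAbove y∈τ N<y = <-irrefl refl
        (<-trans N<y (≤-<-trans (proj₂ (All.lookup (proj₁ (proj₂ (afterTop-shape k m τ∈))) y∈τ)) m<N))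
    topRun-sound (suc m) {N} {k} m<N k≤b p | run {τ = τ} τ∈ =
      Avoids1xx-∷ (proj₁ rest) pair , NoWeakGamma-∷ (proj₂ rest) late
      where
      m<N′ : m < N
      m<N′ = <-trans (n<1+n m) m<N
      rest = topRun-sound m m<N′ (≤-trans pred[n]≤n k≤b) τ∈
      pair : ∀ {y w} → (y ∷ w ∷ []) ⊆ τ → suc m < y → suc m < w → ⊥
      pair s 1+m<y 1+m<w with atMostOneAbove (topRun-shape m m<N′ τ∈) s
      ... | inj₁ y≤m = <-irrefl refl (≤-<-trans y≤m (<-trans (n<1+n m) 1+m<y))
      ... | inj₂ w≤m = <-irrefl refl (≤-<-trans w≤m (<-trans (n<1+n m) 1+m<w))
      late : ∀ {ds e f g} → (ds ++ e ∷ f ∷ g ∷ []) ⊆ τ → length ds ≡ 2 + c → suc m < e → g < f → ⊥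
      late s len 1+m<e = topRun-noLateDescent m m<N′ τ∈ s (<-trans (n<1+n m) 1+m<e)
                           (≤-trans (pred-mono-≤ k≤b) (≤-reflexive (sym len)))

  avoiders-ascendingOrDescent : ∀ m {π} → π ∈ avoiders m → π ∈ ascendingAvoiders m ⊎ HasDescent π
  avoiders-ascendingOrDescent zero    (here refl) = inj₁ (here refl)
  avoiders-ascendingOrDescent (suc m) p with topRun-view m p
  ... | top {τ = []} τ∈ with refl ← proj₁ (afterTop-shape b m τ∈) = inj₁ (here refl)
  ... | top {τ = y ∷ τ} τ∈ with _ , (_ , y≤m) ∷ _ , _ ← afterTop-shape b m τ∈ =
    inj₂ (suc m , y , refl ∷ refl ∷ []⊆-universal τ , s≤s y≤m)
  avoiders-ascendingOrDescent (suc (suc m)) p | run {τ = τ} τ∈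
    with τ | topRun-shape m (<-trans (n<1+n m) (n<1+n (suc m))) τ∈
  ... | a ∷ rest          | _ , inj₁ (_ , a≤m) ∷ _ , _ =
    inj₂ (suc m , a , refl ∷ refl ∷ []⊆-universal rest , s≤s a≤m)
  ... | a ∷ []            | refl , inj₂ refl ∷ _ , _   = inj₁ (here refl)
  ... | a ∷ a′ ∷ rest     | _ , inj₂ refl ∷ inj₁ (_ , a′≤m) ∷ _ , _ =
    inj₂ (suc m , a′ , refl ∷ a ∷ʳ refl ∷ []⊆-universal rest , s≤s a′≤m)
  ... | a ∷ a′ ∷ rest     | _ , inj₂ refl ∷ inj₂ refl ∷ _ , (a∉ ∷ _) = ⊥-elim (All.head a∉ refl)

  -- The run entries already placed in front of the word that topRun generates.
  Prefix : ℕ → ℕ → ℕ → List ℕ → Set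
  Prefix m N k W = Decreasing W × length W ≡ b ∸ k × All (λ w → m < w × w < N) W

  mutual
    avoiders-complete : ∀ m {π} → DistinctWord (InRange m) m π → Avoids1xx π → NoGamma π →
                        π ∈ avoiders m
    avoiders-complete zero    {[]} _                      _  _   = here refl
    avoiders-complete (suc m)      (len , inRange , π!) av noγ =
      topRun-complete m ≤-refl (n<1+n m) (len , All.map split inRange , π!) av ([] , sym (n∸n≡0 b) , []) noγ
      where
      split : ∀ {y} → InRange (suc m) y → InRange m y ⊎ y ≡ suc m
      split (1≤y , y≤1+m) with m≤n⇒m<n∨m≡n y≤1+m
      ... | inj₁ y≤m  = inj₁ (1≤y , ≤-pred y≤m)
      ... | inj₂ y≡1+m = inj₂ y≡1+m

    afterTop-complete : ∀ k m {N τ W} → m < N → DistinctWord (InRange m) m τ → Avoids1xx τ → Prefix m N k W →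
                        NoGamma (W ++ N ∷ τ) → τ ∈ afterTop k m
    afterTop-complete zero m {N} {τ} {W} m<N word@(_ , inRange , _) av (W↓ , len , between) noγ
      with avoiders-ascendingOrDescent m (avoiders-complete m word av (NoGamma-mono (++⁺ˡ W (N ∷ʳ ⊆-refl)) noγ))
    ... | inj₁ τ∈ = τ∈
    ... | inj₂ (f , g , fg⊆τ , g<f) = ⊥-elim (noγ (++⁺ ⊆-refl (refl ∷ fg⊆τ)) len W↓
            (All.map (λ (m<w , w<N) → ≤-<-trans f≤m m<w , w<N) between) (≤-<-trans f≤m m<N) g<f)
      where
      f≤m : f ≤ m
      f≤m = proj₂ (All.lookup inRange (Any-resp-⊆ fg⊆τ (here refl)))
    afterTop-complete (suc k) m {N} {τ} {W} _ word av _ noγ =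
      avoiders-complete m word av (NoGamma-mono (++⁺ˡ W (N ∷ʳ ⊆-refl)) noγ)

    topRun-complete : ∀ m {N k π W} → k ≤ b → m < N → DistinctWord (λ y → InRange m y ⊎ y ≡ N) (suc m) π →
                      Avoids1xx π → Prefix m N k W → NoGamma (W ++ π) → π ∈ topRun m N k
    topRun-complete m {N} {k} {x ∷ τ} k≤b m<N (len , inj₂ refl ∷ inRange , x∉ ∷ τ!) av prefix noγ =
      ∈-++⁺ˡ (∈-map⁺ (N ∷_) (afterTop-complete k m m<N
                                (suc-injective len , All.zipWith below (x∉ , inRange) , τ!)
                                                (av ∘ (N ∷ʳ_)) prefix noγ))
      where
      below : ∀ {y} → N ≢ y × (InRange m y ⊎ y ≡ N) → InRange m y
      below (_   , inj₁ y∈) = y∈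
      below (N≢y , inj₂ refl) = ⊥-elim (N≢y refl)
    topRun-complete m {N} {k} {suc x ∷ τ} k≤b m<N (len , inj₁ (_ , x≤m) ∷ inRange , x∉ ∷ τ!) av prefix noγ
      with m≤n⇒m<n∨m≡n x≤m
    ... | inj₁ x<m =
      ⊥-elim (noPair (two-above (s≤s z≤n) x<m (suc-injective len) τ! (All.zipWith positive (x∉ , inRange))))
      where
      noPair : (∃₂ λ y w → (y ∷ w ∷ []) ⊆ τ × suc x < y × suc x < w) → ⊥
      noPair (_ , _ , yw⊆τ , x<y , x<w) = av (refl ∷ yw⊆τ) x<y x<w
      positive : ∀ {y} → suc x ≢ y × (InRange m y ⊎ y ≡ N) → 1 ≤ y × suc x ≢ y
      positive (x≢y , inj₁ (1≤y , _)) = 1≤y , x≢y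
      positive (x≢y , inj₂ refl)      = ≤-<-trans z≤n m<N , x≢y
    ... | inj₂ refl = run-complete k≤b m<N (suc-injective len) inRange x∉ τ! av prefix noγ

    run-complete : ∀ {m N k τ W} → k ≤ b → suc m < N →
                   length τ ≡ suc m → All (λ y → InRange (suc m) y ⊎ y ≡ N) τ →
                   All (suc m ≢_) τ → Unique τ → Avoids1xx (suc m ∷ τ) → Prefix (suc m) N k W →
                   NoGamma (W ++ suc m ∷ τ) → suc m ∷ τ ∈ topRun (suc m) N k
    run-complete {m} {N} {k} {τ} {W} k≤b 1+m<N len inRange 1+m∉ τ! av (W↓ , lenW , between) noγ =
      ∈-++⁺ʳ (map (N ∷_) (afterTop k (suc m))) (∈-map⁺ (suc m ∷_) (extend k k≤b lenW noγ))
      where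
      m<N : m < N
      m<N = <-trans (n<1+n m) 1+m<N
      word : DistinctWord (λ y → InRange m y ⊎ y ≡ N) (suc m) τ
      word = len , All.zipWith narrow (1+m∉ , inRange) , τ!
        where
        narrow : ∀ {y} → suc m ≢ y × (InRange (suc m) y ⊎ y ≡ N) → InRange m y ⊎ y ≡ N
        narrow (1+m≢y , inj₁ (1≤y , y≤1+m)) = inj₁ (1≤y , ≤-pred (≤∧≢⇒< y≤1+m (1+m≢y ∘ sym)))
        narrow (_     , inj₂ y≡N)           = inj₂ y≡N
      between′ : All (λ w → m < w × w < N) W
      between′ = All.map (λ (1+m<w , w<N) → <-trans (n<1+n m) 1+m<w , w<N) between
      extend : ∀ k → k ≤ b → length W ≡ b ∸ k → NoGamma (W ++ suc m ∷ τ) → τ ∈ topRun m N (ℕ.pred k)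
      extend zero    _   lenW noγ =
        topRun-complete m z≤n m<N word (av ∘ (suc m ∷ʳ_)) (W↓ , lenW , between′)
                        (NoGamma-mono (++⁺ ⊆-refl (suc m ∷ʳ ⊆-refl)) noγ)
      extend (suc k) k<b lenW noγ =
        topRun-complete m (<⇒≤ k<b) m<N word (av ∘ (suc m ∷ʳ_))
          ( AllPairs.++⁺ W↓ ([] ∷ []) (All.map (λ (1+m<w , _) → 1+m<w ∷ []) between)
          , trans (length-++ W) (trans (cong (_+ 1) lenW) (∸-suc+1 k<b))
          , All.++⁺ between′ ((n<1+n m , 1+m<N) ∷ []))
          (subst NoGamma (sym (++-assoc W (suc m ∷ []) τ)) noγ)
        where
        ∸-suc+1 : ∀ {k b} → suc k ≤ b → b ∸ suc k + 1 ≡ b ∸ k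
        ∸-suc+1 {k} {suc b} (s≤s k≤b) = trans (+-comm (b ∸ k) 1) (sym (+-∸-assoc 1 k≤b))

  mutual
    Unique-avoiders : ∀ m → Unique (avoiders m)
    Unique-avoiders zero    = [] ∷ []
    Unique-avoiders (suc m) = Unique-topRun m (n<1+n m)

    Unique-afterTop : ∀ k m → Unique (afterTop k m)
    Unique-afterTop zero    m = Unique-ascending m
    Unique-afterTop (suc k) m = Unique-avoiders m

    Unique-topRun : ∀ m {N k} → m < N → Unique (topRun m N k)
    Unique-topRun zero {N} {k} _ =
      subst Unique (sym (++-identityʳ _)) (Unique.map⁺ ∷-injectiveʳ (Unique-afterTop k zero))
    Unique-topRun (suc m) {N} {k} m<N =
      Unique.++⁺ (Unique.map⁺ ∷-injectiveʳ (Unique-afterTop k (suc m)))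
                 (Unique.map⁺ ∷-injectiveʳ (Unique-topRun m (<-trans (n<1+n m) m<N))) disjoint
      where
      disjoint : ∀ {π} → ¬ (π ∈ map (N ∷_) (afterTop k (suc m)) × π ∈ map (suc m ∷_) (topRun m N (ℕ.pred k)))
      disjoint (p , q) with ∈-map⁻ (N ∷_) p | ∈-map⁻ (suc m ∷_) q
      ... | _ , _ , refl | _ , _ , eq = <-irrefl (sym (∷-injectiveˡ eq)) m<N

  length-gamma : length (gamma b) ≡ b + 3
  length-gamma = trans (cong length gamma≡truncatedGamma)
                       (trans (length-++ (applyDownFrom (_+ 3) b)) (cong (_+ 3) (length-applyDownFrom (_+ 3) b)))

  avoidsAll-patterns⁻ : ∀ {π} → Unique π → T (avoidsAll (patterns b) π) → Avoids1xx π × NoGamma π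
  avoidsAll-patterns⁻ {π} π! t with no132 ∷ no123 ∷ noγ ∷ [] ← all⁺ (λ σ → not (contains σ π)) (patterns b) t =
    avoids1xx , noGamma
    where
    avoids1xx : Avoids1xx π
    avoids1xx {x} {y} {w} s x<y x<w
      with sameOrder-132-or-123 x<y x<w (Unique-pair π! (⊆-trans (x ∷ʳ ⊆-refl) s))
    ... | inj₁ same = T-not⇒¬T no132 (contains⁺ (1 ∷ 3 ∷ 2 ∷ []) _ s refl same)
    ... | inj₂ same = T-not⇒¬T no123 (contains⁺ (1 ∷ 2 ∷ 3 ∷ []) _ s refl same)
    noGamma : NoGamma π
    noGamma {W} s lenW W↓ between f<N g<f = T-not⇒¬T noγ (contains⁺ (gamma b) _ s
      (trans (length-++ W) (trans (cong (_+ 3) lenW) (sym length-gamma)))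
      (gamma-occurrence⁺ lenW W↓ between f<N g<f))

  avoidsAll-patterns⁺ : ∀ {π} → Avoids1xx π → NoWeakGamma π → T (avoidsAll (patterns b) π)
  avoidsAll-patterns⁺ {π} av weak =
    all⁻ (λ σ → not (contains σ π)) {xs = patterns b} (¬T⇒T-not no132 ∷ ¬T⇒T-not no123 ∷ ¬T⇒T-not noγ ∷ [])
    where
    no132 : ¬ T (contains (1 ∷ 3 ∷ 2 ∷ []) π)
    no132 occ with _ , _ , _ , s , x<y , x<w ← contains-1xx⁻ π (s≤s (s≤s z≤n)) (s≤s (s≤s z≤n)) occ = av s x<y x<w
    no123 : ¬ T (contains (1 ∷ 2 ∷ 3 ∷ []) π)
    no123 occ with _ , _ , _ , s , x<y , x<w ← contains-1xx⁻ π (s≤s (s≤s z≤n)) (s≤s (s≤s z≤n)) occ = av s x<y x<w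
    noγ : ¬ T (contains (gamma b) π)
    noγ occ with contains⁻ (gamma b) π occ
    ... | [] , _ , len , _ with () ← trans len length-gamma
    ... | x ∷ τ , s , len , same with splitLast3 (2 + c) τ (suc-injective (trans len length-gamma))
    ...   | ds , e , f , g , refl , lenDs with x<e , g<f ← gamma-occurrence⁻ lenDs same = weak s lenDs x<e g<f

  countAvoiders≡length-avoiders : ∀ n → countAvoiders (patterns b) n ≡ length (avoiders n)
  countAvoiders≡length-avoiders n = countAvoiders-enumeration (patterns b) n (Unique-avoiders n) sound complete
    where
    sound : ∀ {π} → π ∈ avoiders n → DistinctWord (InRange n) n π × T (avoidsAll (patterns b) π)
    sound p with av , weak ← avoiders-sound n p = avoiders-shape n p , avoidsAll-patterns⁺ av weak
    complete : ∀ {π} → DistinctWord (InRange n) n π → T (avoidsAll (patterns b) π) → π ∈ avoiders n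
    complete word@(_ , _ , π!) t with av , noγ ← avoidsAll-patterns⁻ π! t = avoiders-complete n word av noγ

  length-topRun-split : ∀ m {N} k →
                        length (topRun (suc m) N k) ≡ length (afterTop k (suc m)) + length (topRun m N (ℕ.pred k))
  length-topRun-split m {N} k =
    trans (length-++ (map (N ∷_) (afterTop k (suc m))))
          (cong₂ _+_ (length-map (List._∷_ N) (afterTop k (suc m)))
                     (length-map (List._∷_ (suc m)) (topRun m N (ℕ.pred k))))

  length-topRun : ∀ m {N} k → length (topRun m N k) ≡ window (length ∘ avoiders) m k + shift 0 k #ascending≤ m
  length-topRun zero            zero    = refl
  length-topRun zero            (suc k) = refl
  length-topRun (suc m) {N}     zero    = begin
    length (topRun (suc m) N 0)
      ≡⟨ length-topRun-split m 0 ⟩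
    #ascending (suc m) + length (topRun m N 0)
      ≡⟨ cong (λ t → #ascending (suc m) + t) (length-topRun m 0) ⟩
    #ascending (suc m) + #ascending≤ m
      ≡⟨ +-comm (#ascending (suc m)) (#ascending≤ m) ⟩
    #ascending≤ (suc m) ∎
    where open ≡-Reasoning
  length-topRun (suc m) {N}     (suc k) = begin
    length (topRun (suc m) N (suc k))
      ≡⟨ length-topRun-split m (suc k) ⟩
    length (avoiders (suc m)) + length (topRun m N k)
      ≡⟨ cong (λ t → length (avoiders (suc m)) + t) (length-topRun m k) ⟩
    length (avoiders (suc m)) + (window (length ∘ avoiders) m k + shift 0 k #ascending≤ m)
      ≡⟨ +-assoc (length (avoiders (suc m))) _ _ ⟨
    window (length ∘ avoiders) (suc m) (suc k) + shift 0 (suc k) #ascending≤ (suc m) ∎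
    where open ≡-Reasoning


  avoiders-recurrence : WindowRecurrence b #ascending≤ (length ∘ avoiders)
  avoiders-recurrence n = length-topRun n b

  closedForm : ℕ → ℕ
  closedForm n = fibSum b (n ∸ 1) + 2 * fibSum b (n ∸ 2)

  closedForm-recurrence : WindowRecurrence b #ascending≤ (λ n → closedForm n + #ascending n)
  closedForm-recurrence zero          = refl
  closedForm-recurrence (suc zero)    = refl
  closedForm-recurrence (suc (suc n)) = begin
    fibSum b (2 + n) + 2 * fibSum b (1 + n) + 0
      ≡⟨ cong₂ (λ x y → x + 2 * y + 0) (fibSum-rec b (suc n)) (fibSum-rec b n) ⟩
    1 + X + 2 * (1 + Y) + 0
      ≡⟨ rearrange X Y ⟩
    X + 2 * Y + 3
      ≡⟨ cong (λ t → X + 2 * Y + t) (#ascending≤-saturated n) ⟨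
    X + 2 * Y + #ascending≤ (2 + n)
      ≡⟨ cong (λ t → X + 2 * Y + t)
              (window+shift-partialSum {#ascending≤} {#ascending} #ascending≤-partialSum (2 + n) b) ⟨
    X + 2 * Y + (window #ascending (2 + n) b + shift 0 b #ascending≤ (2 + n))
      ≡⟨ cong₂ (λ x y → x + y + (window #ascending (2 + n) b + shift 0 b #ascending≤ (2 + n))) X≡ 2Y≡ ⟨
    window (λ j → fibSum b (j ∸ 1)) (2 + n) b + window (λ j → 2 * fibSum b (j ∸ 2)) (2 + n) b
      + (window #ascending (2 + n) b + shift 0 b #ascending≤ (2 + n))
      ≡⟨ cong (λ t → t + (window #ascending (2 + n) b + shift 0 b #ascending≤ (2 + n)))
              (window-+ (λ j → fibSum b (j ∸ 1)) (λ j → 2 * fibSum b (j ∸ 2)) (2 + n) b) ⟨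
    window closedForm (2 + n) b + (window #ascending (2 + n) b + shift 0 b #ascending≤ (2 + n))
      ≡⟨ +-assoc (window closedForm (2 + n) b) _ _ ⟨
    window closedForm (2 + n) b + window #ascending (2 + n) b + shift 0 b #ascending≤ (2 + n)
      ≡⟨ cong (_+ shift 0 b #ascending≤ (2 + n)) (window-+ closedForm #ascending (2 + n) b) ⟨
    window (λ j → closedForm j + #ascending j) (2 + n) b + shift 0 b #ascending≤ (2 + n)
      ∎
    where
    open ≡-Reasoning
    X Y : ℕ
    X = window (fibSum b) (1 + n) b
    Y = window (fibSum b) n b
    X≡ : window (λ j → fibSum b (j ∸ 1)) (2 + n) b ≡ X
    X≡ = window-suc {λ j → fibSum b (j ∸ 1)} refl (λ _ → refl) (1 + n) b
    2Y≡ : window (λ j → 2 * fibSum b (j ∸ 2)) (2 + n) b ≡ 2 * Y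
    2Y≡ = trans (window-* 2 (λ j → fibSum b (j ∸ 2)) (2 + n) b)
                (cong (2 *_) (trans (window-suc {λ j → fibSum b (j ∸ 2)} refl (λ _ → refl) (1 + n) b)
                                    (window-suc {λ j → fibSum b (j ∸ 1)} refl (λ _ → refl) n b)))
    rearrange : ∀ x y → 1 + x + 2 * (1 + y) + 0 ≡ x + 2 * y + 3
    rearrange = solve-∀

  length-avoiders : ∀ n → length (avoiders n) ≡ closedForm n + #ascending n
  length-avoiders = WindowRecurrence-unique {b} {#ascending≤} avoiders-recurrence closedForm-recurrence refl

  countAvoiders≡closedForm : ∀ n → 3 ≤ n → countAvoiders (patterns b) n ≡ closedForm n
  countAvoiders≡closedForm n@(suc (suc (suc _))) _ =
    trans (countAvoiders≡length-avoiders n) (trans (length-avoiders n) (+-identityʳ (closedForm n)))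
  countAvoiders≡closedForm (suc zero)       (s≤s ())
  countAvoiders≡closedForm (suc (suc zero)) (s≤s (s≤s ()))

  -- weightedFibSum k p = Σ_{j<k} (k − j) F_{b,p−j}
  weightedFibSum : ℕ → ℕ → ℕ
  weightedFibSum zero    p = 0
  weightedFibSum (suc k) p = suc k * F b p + weightedFibSum k (ℕ.pred p)

  weightedFibSum-1 : ∀ k → weightedFibSum k 1 ≡ k
  weightedFibSum-1 zero    = refl
  weightedFibSum-1 (suc k) = trans (cong₂ _+_ (*-identityʳ (suc k)) (weightedFibSum-0 k)) (+-identityʳ (suc k))
    where
    weightedFibSum-0 : ∀ k → weightedFibSum k 0 ≡ 0
    weightedFibSum-0 zero    = refl
    weightedFibSum-0 (suc k) = trans (cong (_+ weightedFibSum k 0) (*-zeroʳ (suc k))) (weightedFibSum-0 k)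

  weightedFibSum-suc : ∀ k p → weightedFibSum (suc k) p ≡ weightedFibSum k p + window (F b) p (suc k)
  weightedFibSum-suc zero    p =
    trans (+-identityʳ (1 * F b p))
          (trans (*-identityˡ (F b p)) (trans (sym (+-identityʳ (F b p))) (sym (window-pred refl p 0))))
  weightedFibSum-suc (suc k) p = begin
    (2 + k) * F b p + weightedFibSum (suc k) (ℕ.pred p)
      ≡⟨ cong (λ t → (2 + k) * F b p + t) (weightedFibSum-suc k (ℕ.pred p)) ⟩
    (2 + k) * F b p + (weightedFibSum k (ℕ.pred p) + window (F b) (ℕ.pred p) (suc k))
      ≡⟨ regroup k (F b p) (weightedFibSum k (ℕ.pred p)) (window (F b) (ℕ.pred p) (suc k)) ⟩
    (1 + k) * F b p + weightedFibSum k (ℕ.pred p) + (F b p + window (F b) (ℕ.pred p) (suc k))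
      ≡⟨ cong (λ t → (1 + k) * F b p + weightedFibSum k (ℕ.pred p) + t) (window-pred refl p (suc k)) ⟨
    weightedFibSum (suc k) p + window (F b) p (2 + k)
      ∎
    where
    open ≡-Reasoning
    regroup : ∀ k x r y → (2 + k) * x + (r + y) ≡ (1 + k) * x + r + (x + y)
    regroup = solve-∀

  weightedFibSum-step : ∀ k p →
                        weightedFibSum k (suc p) + window (F b) p k ≡ k * F b (suc p) + weightedFibSum k p
  weightedFibSum-step zero    p = refl
  weightedFibSum-step (suc k) p =
    trans (+-assoc (suc k * F b (suc p)) (weightedFibSum k p) (window (F b) p (suc k)))
          (cong (λ t → suc k * F b (suc p) + t) (sym (weightedFibSum-suc k p)))

  F-unfold : ∀ q → F b (5 + q) ≡ F b (4 + q) + F b (3 + q) + F b (2 + q) + window (F b) (1 + q) c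
  F-unfold q = begin
    F b (5 + q)
      ≡⟨ F-rec b (3 + q) ⟩
    F b (4 + q) + (F b (3 + q) + (F b (2 + q) + window (F b ∘ suc) q c))
      ≡⟨ cong (λ t → F b (4 + q) + (F b (3 + q) + (F b (2 + q) + t))) (window-suc {F b} refl (λ _ → refl) q c) ⟨
    F b (4 + q) + (F b (3 + q) + (F b (2 + q) + window (F b) (1 + q) c))
      ≡⟨ reassociate (F b (4 + q)) (F b (3 + q)) (F b (2 + q)) _ ⟩
    F b (4 + q) + F b (3 + q) + F b (2 + q) + window (F b) (1 + q) c ∎
    where
    open ≡-Reasoning
    reassociate : ∀ a b c d → a + (b + (c + d)) ≡ a + b + c + d
    reassociate = solve-∀

  closedForm-suc : ∀ q → closedForm (4 + q) ≡ closedForm (3 + q) + F b (3 + q) + 2 * F b (2 + q)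
  closedForm-suc q = trans (cong₂ (λ x y → x + 2 * y) (fibSum-suc b (2 + q)) (fibSum-suc b (1 + q)))
                           (regroup (fibSum b (2 + q)) (fibSum b (1 + q)) (F b (2 + q)) (F b (3 + q)))
    where
    regroup : ∀ s₂ s₁ f₂ f₃ → s₂ + f₃ + 2 * (s₁ + f₂) ≡ s₂ + 2 * s₁ + f₃ + 2 * f₂
    regroup = solve-∀

  -- The first formula for n = q + 3, with the subtractions moved to the other side.
  closedForm-identity : ∀ q → (c + 2) * closedForm (3 + q) + 3 + F b (2 + q)
                              ≡ 3 * F b (4 + q) + c * F b (2 + q) + 3 * weightedFibSum c (1 + q)
  closedForm-identity zero = begin
    (c + 2) * closedForm 3 + 3 + F b 2
      ≡⟨ base c ⟩
    3 * 4 + c * 1 + 3 * c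
      ≡⟨ cong₂ (λ x y → 3 * x + c * 1 + 3 * y) (F-rec b 2) (weightedFibSum-1 c) ⟨
    3 * F b 4 + c * F b 2 + 3 * weightedFibSum c 1 ∎
    where
    open ≡-Reasoning
    base : ∀ c → (c + 2) * 4 + 3 + 1 ≡ 3 * 4 + c * 1 + 3 * c
    base = solve-∀
  closedForm-identity (suc q) = +-cancelʳ-≡ (3 * w) _ _ (begin
    (c + 2) * closedForm (4 + q) + 3 + f₃ + 3 * w
      ≡⟨ cong (λ x → (c + 2) * x + 3 + f₃ + 3 * w) (closedForm-suc q) ⟩
    (c + 2) * (t + f₃ + 2 * f₂) + 3 + f₃ + 3 * w
      ≡⟨ regroup₁ c t f₂ f₃ w ⟩
    ((c + 2) * t + 3 + f₂) + (c + 3) * f₃ + (2 * c + 3) * f₂ + 3 * w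
      ≡⟨ cong (λ x → x + (c + 3) * f₃ + (2 * c + 3) * f₂ + 3 * w) (closedForm-identity q) ⟩
    (3 * f₄ + c * f₂ + 3 * r₁) + (c + 3) * f₃ + (2 * c + 3) * f₂ + 3 * w
      ≡⟨ regroup₂ c f₂ f₃ f₄ r₁ w ⟩
    3 * (f₄ + f₃ + f₂ + w) + c * f₃ + 3 * (c * f₂ + r₁)
      ≡⟨ cong₂ (λ x y → 3 * x + c * f₃ + 3 * y) (F-unfold q) (weightedFibSum-step c (1 + q)) ⟨
    3 * f₅ + c * f₃ + 3 * (r₂ + w)
      ≡⟨ regroup₃ c f₃ f₅ r₂ w ⟩
    3 * f₅ + c * f₃ + 3 * r₂ + 3 * w
      ∎)
    where
    open ≡-Reasoning
    t = closedForm (3 + q)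
    f₂ = F b (2 + q)
    f₃ = F b (3 + q)
    f₄ = F b (4 + q)
    f₅ = F b (5 + q)
    w = window (F b) (1 + q) c
    r₁ = weightedFibSum c (1 + q)
    r₂ = weightedFibSum c (2 + q)
    regroup₁ : ∀ c t f₂ f₃ w → (c + 2) * (t + f₃ + 2 * f₂) + 3 + f₃ + 3 * w
                               ≡ ((c + 2) * t + 3 + f₂) + (c + 3) * f₃ + (2 * c + 3) * f₂ + 3 * w
    regroup₁ = solve-∀
    regroup₂ : ∀ c f₂ f₃ f₄ r₁ w → (3 * f₄ + c * f₂ + 3 * r₁) + (c + 3) * f₃ + (2 * c + 3) * f₂ + 3 * w
                                   ≡ 3 * (f₄ + f₃ + f₂ + w) + c * f₃ + 3 * (c * f₂ + r₁)
    regroup₂ = solve-∀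
    regroup₃ : ∀ c f₃ f₅ r₂ w → 3 * f₅ + c * f₃ + 3 * (r₂ + w) ≡ 3 * f₅ + c * f₃ + 3 * r₂ + 3 * w
    regroup₃ = solve-∀

  weightedFibSum-as-sum : ∀ k p → sum (map (λ j → (k ∸ j) * F b (p ∸ j)) (upTo k)) ≡ weightedFibSum k p
  weightedFibSum-as-sum zero    p = refl
  weightedFibSum-as-sum (suc k) p = cong (λ t → suc k * F b p + t) (begin
    sum (map term (applyUpTo suc k))
      ≡⟨ cong (sum ∘ map term) (map-upTo suc k) ⟨
    sum (map term (map suc (upTo k)))
      ≡⟨ cong sum (map-∘ {g = term} {f = suc} (upTo k)) ⟨
    sum (map (term ∘ suc) (upTo k))
      ≡⟨ cong sum (map-cong (λ j → cong (λ x → (k ∸ j) * F b x) (∸-suc p j)) (upTo k)) ⟩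
    sum (map (λ j → (k ∸ j) * F b (ℕ.pred p ∸ j)) (upTo k))
      ≡⟨ weightedFibSum-as-sum k (ℕ.pred p) ⟩
    weightedFibSum k (ℕ.pred p) ∎)
    where
    open ≡-Reasoning
    term : ℕ → ℕ
    term j = (suc k ∸ j) * F b (p ∸ j)
    ∸-suc : ∀ p j → p ∸ suc j ≡ ℕ.pred p ∸ j
    ∸-suc zero    j = sym (0∸n≡0 j)
    ∸-suc (suc p) j = refl

  sumℤ-weightedFibSum : ∀ q →
                        sumℤ 3 (b ∸ 1) (λ i → + (b ∸ i) ℤ.* + F b (3 + q + 1 ∸ i)) ≡ + weightedFibSum c (1 + q)
  sumℤ-weightedFibSum q = begin
    foldr ℤ._+_ (+ 0) (map term (map (λ j → 3 + j) (upTo c)))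
      ≡⟨ cong (foldr ℤ._+_ (+ 0)) (map-shifted (upTo c)) ⟩
    foldr ℤ._+_ (+ 0) (map (λ j → + ((c ∸ j) * F b (1 + q ∸ j))) (upTo c))
      ≡⟨ foldr-pos (λ j → (c ∸ j) * F b (1 + q ∸ j)) (upTo c) ⟩
    + sum (map (λ j → (c ∸ j) * F b (1 + q ∸ j)) (upTo c))
      ≡⟨ cong +_ (weightedFibSum-as-sum c (1 + q)) ⟩
    + weightedFibSum c (1 + q) ∎
    where
    open ≡-Reasoning
    term : ℕ → ℤ
    term i = + (b ∸ i) ℤ.* + F b (3 + q + 1 ∸ i)
    map-shifted : ∀ js → map term (map (λ j → 3 + j) js) ≡ map (λ j → + ((c ∸ j) * F b (1 + q ∸ j))) js
    map-shifted []       = refl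
    map-shifted (j ∷ js) =
      cong₂ _∷_ (trans (cong (λ y → + (c ∸ j) ℤ.* + F b (y ∸ j)) (+-comm q 1)) (sym (ℤP.pos-* (c ∸ j) _)))
                (map-shifted js)
    foldr-pos : ∀ (h : ℕ → ℕ) js → foldr ℤ._+_ (+ 0) (map (λ j → + h j) js) ≡ + sum (map h js)
    foldr-pos h []       = refl
    foldr-pos h (j ∷ js) = cong (λ z → + h j ℤ.+ z) (foldr-pos h js)

  countAvoiders-weightedIdentity : ∀ n → 3 ≤ n →
      (+ (b ∸ 1)) ℤ.* (+ countAvoiders (patterns b) n)
        ≡ (+ 3) ℤ.* (+ F b (n + 1))
          ℤ.+ ((+ b) ℤ.- (+ 4)) ℤ.* (+ F b (n ∸ 1))
          ℤ.+ (+ 3) ℤ.* sumℤ 3 (b ∸ 1) (λ i → (+ (b ∸ i)) ℤ.* (+ F b (n + 1 ∸ i)))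
          ℤ.- (+ 3)
  countAvoiders-weightedIdentity n@(suc (suc (suc q))) 3≤n = begin
    + (2 + c) ℤ.* + countAvoiders (patterns b) n
      ≡⟨ cong (λ t → + (2 + c) ℤ.* + t) (countAvoiders≡closedForm n 3≤n) ⟩
    + (2 + c) ℤ.* + t
      ≡⟨ expand (+ c) (+ t) (+ f₂) ⟩
    (+ c ℤ.+ + 2) ℤ.* + t ℤ.+ + 3 ℤ.+ + f₂ ℤ.- + 3 ℤ.- + f₂
      ≡⟨ cong (λ z → z ℤ.+ + 3 ℤ.+ + f₂ ℤ.- + 3 ℤ.- + f₂) (ℤP.pos-* (c + 2) t) ⟨
    + ((c + 2) * t + 3 + f₂) ℤ.- + 3 ℤ.- + f₂
      ≡⟨ cong (λ z → + z ℤ.- + 3 ℤ.- + f₂) (closedForm-identity q) ⟩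
    + (3 * f₄ + c * f₂ + 3 * r) ℤ.- + 3 ℤ.- + f₂
      ≡⟨ cong₂ (λ x y → x ℤ.+ y ℤ.+ + (3 * r) ℤ.- + 3 ℤ.- + f₂) (ℤP.pos-* 3 f₄) (ℤP.pos-* c f₂) ⟩
    + 3 ℤ.* + f₄ ℤ.+ + c ℤ.* + f₂ ℤ.+ + (3 * r) ℤ.- + 3 ℤ.- + f₂
      ≡⟨ cong (λ z → + 3 ℤ.* + f₄ ℤ.+ + c ℤ.* + f₂ ℤ.+ z ℤ.- + 3 ℤ.- + f₂) (ℤP.pos-* 3 r) ⟩
    + 3 ℤ.* + f₄ ℤ.+ + c ℤ.* + f₂ ℤ.+ + 3 ℤ.* + r ℤ.- + 3 ℤ.- + f₂
      ≡⟨ collect (+ c) (+ f₄) (+ f₂) (+ r) ⟩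
    + 3 ℤ.* + f₄ ℤ.+ ((+ 3 ℤ.+ + c) ℤ.- + 4) ℤ.* + f₂ ℤ.+ + 3 ℤ.* + r ℤ.- + 3
      ≡⟨ cong₂ (λ x y → + 3 ℤ.* + F b x ℤ.+ ((+ 3 ℤ.+ + c) ℤ.- + 4) ℤ.* + f₂ ℤ.+ + 3 ℤ.* y ℤ.- + 3)
               (+-comm n 1) (sumℤ-weightedFibSum q) ⟨
    + 3 ℤ.* + F b (n + 1) ℤ.+ ((+ b) ℤ.- + 4) ℤ.* + F b (n ∸ 1)
      ℤ.+ + 3 ℤ.* sumℤ 3 (b ∸ 1) (λ i → + (b ∸ i) ℤ.* + F b (n + 1 ∸ i)) ℤ.- + 3
      ∎
    where
    open ≡-Reasoning
    t = closedForm n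
    f₂ = F b (2 + q)
    f₄ = F b (4 + q)
    r = weightedFibSum c (1 + q)
    expand : ∀ c t f → (+ 2 ℤ.+ c) ℤ.* t ≡ (c ℤ.+ + 2) ℤ.* t ℤ.+ + 3 ℤ.+ f ℤ.- + 3 ℤ.- f
    expand = ℤ-solve-∀
    collect : ∀ c a f r → + 3 ℤ.* a ℤ.+ c ℤ.* f ℤ.+ + 3 ℤ.* r ℤ.- + 3 ℤ.- f
                          ≡ + 3 ℤ.* a ℤ.+ ((+ 3 ℤ.+ c) ℤ.- + 4) ℤ.* f ℤ.+ + 3 ℤ.* r ℤ.- + 3
    collect = ℤ-solve-∀
  countAvoiders-weightedIdentity (suc zero)       (s≤s ())
  countAvoiders-weightedIdentity (suc (suc zero)) (s≤s (s≤s ()))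

  P : Series
  P = mono (+ 1) 0 ⊕ mono (ℤ.- (+ 2)) 1 ⊕ mono (+ 1) (b + 1)

  ⊗P : ∀ f m → (f ⊗ P) m ≡ f m ℤ.* + 1 ℤ.+ shift (+ 0) 1 f m ℤ.* ℤ.- (+ 2) ℤ.+ shift (+ 0) (suc b) f m ℤ.* + 1
  ⊗P f m = begin
    (f ⊗ P) m
      ≡⟨ ⊗-distribˡ-⊕ f (mono (+ 1) 0 ⊕ mono (ℤ.- (+ 2)) 1) (mono (+ 1) (b + 1)) m ⟩
    (f ⊗ (mono (+ 1) 0 ⊕ mono (ℤ.- (+ 2)) 1)) m ℤ.+ (f ⊗ mono (+ 1) (b + 1)) m
      ≡⟨ cong₂ ℤ._+_ (⊗-distribˡ-⊕ f (mono (+ 1) 0) (mono (ℤ.- (+ 2)) 1) m) (⊗-mono f (+ 1) (b + 1) m) ⟩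
    (f ⊗ mono (+ 1) 0) m ℤ.+ (f ⊗ mono (ℤ.- (+ 2)) 1) m ℤ.+ shift (+ 0) (b + 1) f m ℤ.* + 1
      ≡⟨ cong₂ (λ x y → x ℤ.+ y ℤ.+ shift (+ 0) (b + 1) f m ℤ.* + 1) (⊗-mono f (+ 1) 0 m) (⊗-mono f (ℤ.- (+ 2)) 1 m) ⟩
    f m ℤ.* + 1 ℤ.+ shift (+ 0) 1 f m ℤ.* ℤ.- (+ 2) ℤ.+ shift (+ 0) (b + 1) f m ℤ.* + 1
      ≡⟨ cong (λ k → f m ℤ.* + 1 ℤ.+ shift (+ 0) 1 f m ℤ.* ℤ.- (+ 2) ℤ.+ shift (+ 0) k f m ℤ.* + 1) (+-comm b 1) ⟩
    f m ℤ.* + 1 ℤ.+ shift (+ 0) 1 f m ℤ.* ℤ.- (+ 2) ℤ.+ shift (+ 0) (suc b) f m ℤ.* + 1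
      ∎
    where open ≡-Reasoning

  -- The theorem's generating-function identity is A · P = Q · P + R.
  A Q Q′ R : Series
  A m = + length (avoiders m)
  Q = mono (+ 1) 0 ⊕ mono (+ 1) 1 ⊕ mono (+ 1) 2
  Q′ m = + #ascending m
  R = mono (+ 1) 2 ⊕ mono (+ 2) 3

  Q≗Q′ : ∀ m → Q m ≡ Q′ m
  Q≗Q′ zero                = refl
  Q≗Q′ (suc zero)          = refl
  Q≗Q′ (suc (suc zero))    = refl
  Q≗Q′ (suc (suc (suc m))) = refl

  ⊗P-from-2 : ∀ f n → ((+_ ∘ f) ⊗ P) (2 + n)
                      ≡ + f (2 + n) ℤ.* + 1 ℤ.+ + f (1 + n) ℤ.* ℤ.- (+ 2) ℤ.+ + shift 0 (2 + c) f n ℤ.* + 1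
  ⊗P-from-2 f n = trans (⊗P (+_ ∘ f) (2 + n))
    (cong (λ z → + f (2 + n) ℤ.* + 1 ℤ.+ + f (1 + n) ℤ.* ℤ.- (+ 2) ℤ.+ z ℤ.* + 1) (shift-map +_ 0 (2 + c) f n))

  A-secondDifference : ∀ n → (A ⊗ P) (2 + n) ≡ + shift 0 (2 + c) #ascending n
  A-secondDifference n = trans (⊗P-from-2 (length ∘ avoiders) n)
    (second-difference-ℤ (length (avoiders (2 + n))) (length (avoiders (1 + n))) (shift 0 (2 + c) (length ∘ avoiders) n) _
      (WindowRecurrence-secondOrder {2 + c} {#ascending≤} #ascending≤-partialSum avoiders-recurrence n))

  Q′-secondDifference : ∀ n → (Q′ ⊗ P) (2 + n) ℤ.+ R (2 + n) ≡ + shift 0 (2 + c) #ascending n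
  Q′-secondDifference n = trans (cong (ℤ._+ R (2 + n)) (⊗P-from-2 #ascending n)) (small n (+ shift 0 (2 + c) #ascending n))
    where
    small : ∀ n s → Q′ (2 + n) ℤ.* + 1 ℤ.+ Q′ (1 + n) ℤ.* ℤ.- (+ 2) ℤ.+ s ℤ.* + 1 ℤ.+ R (2 + n) ≡ s
    small zero          = ℤ-solve-∀
    small (suc zero)    = ℤ-solve-∀
    small (suc (suc n)) = ℤ-solve-∀

  A⊗P≡Q⊗P+R : ∀ m → (A ⊗ P) m ≡ (Q′ ⊗ P) m ℤ.+ R m
  A⊗P≡Q⊗P+R zero          = trans (⊗P A 0) (sym (cong (ℤ._+ R 0) (⊗P Q′ 0)))
  A⊗P≡Q⊗P+R (suc zero)    = trans (⊗P A 1) (sym (cong (ℤ._+ R 1) (⊗P Q′ 1)))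
  A⊗P≡Q⊗P+R (suc (suc n)) = trans (A-secondDifference n) (sym (Q′-secondDifference n))

  generatingFunction : ∀ m → (ogf (patterns b) ⊗ P) m ≡ ((Q ⊗ P) ⊕ R) m
  generatingFunction m = begin
    (ogf (patterns b) ⊗ P) m ≡⟨ ⊗-congˡ P m (cong +_ ∘ countAvoiders≡length-avoiders) ⟩
    (A ⊗ P) m                ≡⟨ A⊗P≡Q⊗P+R m ⟩
    (Q′ ⊗ P) m ℤ.+ R m       ≡⟨ cong (ℤ._+ R m) (⊗-congˡ P m (sym ∘ Q≗Q′)) ⟩
    (Q ⊗ P) m ℤ.+ R m        ∎
    where open ≡-Reasoning

mainTheorem9 : (b : ℕ) → 3 ≤ b →
    ((n : ℕ) → 3 ≤ n →
        (+ (b ∸ 1)) ℤ.* (+ countAvoiders (patterns b) n)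
          ≡ (+ 3) ℤ.* (+ F b (n + 1))
            ℤ.+ ((+ b) ℤ.- (+ 4)) ℤ.* (+ F b (n ∸ 1))
            ℤ.+ (+ 3) ℤ.* sumℤ 3 (b ∸ 1) (λ i → (+ (b ∸ i)) ℤ.* (+ F b (n + 1 ∸ i)))
            ℤ.- (+ 3))
    × ((n : ℕ) → 3 ≤ n →
        countAvoiders (patterns b) n
          ≡ sumℕ 1 (n ∸ 1) (F b) + 2 * sumℕ 1 (n ∸ 2) (F b))
    × ((m : ℕ) →
        (ogf (patterns b) ⊗ (mono (+ 1) 0 ⊕ mono (ℤ.- (+ 2)) 1 ⊕ mono (+ 1) (b + 1))) m
          ≡ (((mono (+ 1) 0 ⊕ mono (+ 1) 1 ⊕ mono (+ 1) 2)
                ⊗ (mono (+ 1) 0 ⊕ mono (ℤ.- (+ 2)) 1 ⊕ mono (+ 1) (b + 1)))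
              ⊕ (mono (+ 1) 2 ⊕ mono (+ 2) 3)) m)
mainTheorem9 (suc (suc (suc c))) (s≤s (s≤s (s≤s z≤n))) =
  countAvoiders-weightedIdentity , countAvoiders≡closedForm , generatingFunction
  where open Counting c
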